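{- For every integer $j\ge 0$, with $c_0=2$ and $c_n=1$ for $n>0$, \[ {}_2F_1\!\left(\begin{matrix}-\tfrac j2,\ \tfrac{1-j}{2}\\ -j\end{matrix}\,\Big|\,-4\right) =\sum_{m=0}^{\left\lfloor j/2\right\rfloor}\frac{1}{c_{j-2m}}\binom{j-m}{j-2m}2^{ -j+2m+1}\,{}_{2}F_{1}\!\left(\begin{matrix}-m,\ j-m+1\\ j-2m+1\end{matrix}\,\Big|\,-\tfrac14\right) =\frac{1}{2^j}\sum_{m=0}^{\left\lfloor j/2\right\rfloor}\binom{j}{m}\frac{(j-2m+1)^2}{j-m+1}\,{}_{2}F_{1}\!\left(\begin{matrix}-m,\ -j+m-1\\ -j\end{matrix}\,\Big|\,-4\right), \] and \[ {}_2F_1\!\left(\begin{matrix}-\tfrac j2,\ \tfrac{1-j}{2}\\ \tfrac32\end{matrix}\,\Big|\,5\right) =\frac{2}{j+1}\sum_{m=0}^{\left\lfloor j/2\right\rfloor}\frac{5^m}{c_{j-2m}}\binom{j-m}{j-2m}\,{}_{2}F_{1}\!\left(\begin{matrix}-m,\ -m\\ j-2m+1\end{matrix}\,\Big|\,\tfrac15\right) =\frac{1}{j+1}\sum_{m=0}^{\left\lfloor j/2\right\rfloor}5^m\binom{j}{m}\frac{(j-2m+1)^2}{j-m+1}\,{}_{2}F_{1}\!\left(\begin{matrix}-m,\ 1-m\\ -j\end{matrix}\,\Big|\,\tfrac45\right). \]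
   Context: Here ${}_2F_1\!\left(\begin{smallmatrix}a,\ b\\ c\end{smallmatrix}\big|z\right)=\sum_{k\ge 0}\frac{(a)_k(b)_k}{(c)_k\,k!}z^k$ with $(a)_k=a(a+1)\cdots(a+k-1)$; in every series above one upper parameter is a nonpositive integer $-N$ (for the left-hand sides, whichever of $-j/2$, $(1-j)/2$ is an integer), and the series is understood as the terminating finite sum over $0\le k\le N$. -}

module Defs where

open import Data.Nat as ℕ using (ℕ; zero; suc; _∸_; ⌊_/2⌋; _!)
open import Data.Nat.Combinatorics using (_C_)
open import Data.Integer using (+_)
open import Data.Rational using (ℚ; 0ℚ; 1ℚ; _+_; _*_; -_; _-_; _÷_; _/_; ≢-nonZero)
open import Data.Rational.Properties using (_≟_)
open import Relation.Nullary using (yes; no)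

qℕ : ℕ → ℚ
qℕ n = + n / 1

-- division on ℚ; only ever applied to nonzero denominators in the statement
-- (the value chosen for a zero denominator is irrelevant)
_÷'_ : ℚ → ℚ → ℚ
p ÷' q with q ≟ 0ℚ
... | yes _ = 0ℚ
... | no q≢0 = _÷_ p q {{≢-nonZero q≢0}}
infixl 7 _÷'_

_^'_ : ℚ → ℕ → ℚ
p ^' zero = 1ℚ
p ^' suc n = p * (p ^' n)
infixr 8 _^'_

poch : ℚ → ℕ → ℚ
poch a zero = 1ℚ
poch a (suc k) = poch a k * (a + qℕ k)

sumTo : ℕ → (ℕ → ℚ) → ℚ
sumTo zero f = f 0
sumTo (suc N) f = sumTo N f + f (suc N)

-- terminating 2F1(a, b; c | z) = Σ_{k=0}^{N} (a)_k (b)_k / ((c)_k k!) z^k,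
-- where -N is the nonpositive integer upper parameter
F21 : ℕ → ℚ → ℚ → ℚ → ℚ → ℚ
F21 N a b c z = sumTo N (λ k → (poch a k * poch b k * z ^' k) ÷' (poch c k * qℕ (k !)))

cc : ℕ → ℚ
cc zero = qℕ 2
cc (suc _) = 1ℚ

half : ℚ
half = + 1 / 2

lhsA : ℕ → ℚ
lhsA j = F21 ⌊ j /2⌋ (- (qℕ j * half)) ((1ℚ - qℕ j) * half) (- qℕ j) (- qℕ 4)

midA : ℕ → ℚ
midA j = sumTo ⌊ j /2⌋ (λ m →
  (1ℚ ÷' cc (j ∸ 2 ℕ.* m)) * qℕ ((j ∸ m) C (j ∸ 2 ℕ.* m))
  * (qℕ 2 ^' (2 ℕ.* m ℕ.+ 1) ÷' qℕ 2 ^' j)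
  * F21 m (- qℕ m) (qℕ (j ∸ m ℕ.+ 1)) (qℕ (j ∸ 2 ℕ.* m ℕ.+ 1)) (- (+ 1 / 4)))

rhsA : ℕ → ℚ
rhsA j = (1ℚ ÷' qℕ 2 ^' j) * sumTo ⌊ j /2⌋ (λ m →
  qℕ (j C m) * (qℕ ((j ∸ 2 ℕ.* m ℕ.+ 1) ℕ.^ 2) ÷' qℕ (j ∸ m ℕ.+ 1))
  * F21 m (- qℕ m) (- qℕ (j ∸ m ℕ.+ 1)) (- qℕ j) (- qℕ 4))

lhsB : ℕ → ℚ
lhsB j = F21 ⌊ j /2⌋ (- (qℕ j * half)) ((1ℚ - qℕ j) * half) (+ 3 / 2) (qℕ 5)

midB : ℕ → ℚ
midB j = (qℕ 2 ÷' qℕ (j ℕ.+ 1)) * sumTo ⌊ j /2⌋ (λ m →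
  (qℕ 5 ^' m ÷' cc (j ∸ 2 ℕ.* m)) * qℕ ((j ∸ m) C (j ∸ 2 ℕ.* m))
  * F21 m (- qℕ m) (- qℕ m) (qℕ (j ∸ 2 ℕ.* m ℕ.+ 1)) (+ 1 / 5))

rhsB : ℕ → ℚ
rhsB j = (1ℚ ÷' qℕ (j ℕ.+ 1)) * sumTo ⌊ j /2⌋ (λ m →
  qℕ 5 ^' m * qℕ (j C m) * (qℕ ((j ∸ 2 ℕ.* m ℕ.+ 1) ℕ.^ 2) ÷' qℕ (j ∸ m ℕ.+ 1))
  * F21 m (- qℕ m) (1ℚ - qℕ m) (- qℕ j) (+ 4 / 5))

module Submission where

-- Each side is brought to one of two closed forms. Both left-hand sides are
-- summed term by term with the duplication formula
-- (-j/2)_k ((1-j)/2)_k 4^k = (-j)_{2k}, giving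
--   F(j+1) = Σ_k C(j-k, k)   and   (1/(j+1)) Σ_k 5^k C(j+1, 2k+1).
-- In the middle expressions the inner 2F1 is expanded and the triangular double
-- sum is re-indexed along anti-diagonals; the inner sums that appear are
-- palindromic binomial sums equal to 2^n (A) or Vandermonde convolutions (B).
-- For rhsA the inner sums are Σ_l C(n+1, l) (n+1-2l)^2 = (n+1) 2^n. For rhsB,
-- Pfaff's transformation 5^m 2F1(-m, b; c | 4/5) = 2F1(-m, c-b; c | -4) gives
-- rhsB = 2^j rhsA / (j+1), and the two closed forms are related by
-- Σ_k 5^k C(n, 2k+1) = 2^(n-1) F(n): both sides satisfy a(n+2) = 2 a(n+1) + 4 a(n).

open import Defs
open import Data.Nat as ℕ using (ℕ; zero; suc; _≤_; _<_; z≤n; s≤s; _∸_; ⌊_/2⌋; _!)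
import Data.Nat.Properties as NP
import Data.Nat.Solver
open import Data.Nat.Combinatorics as NC using (_C_)
open import Data.Nat.Divisibility using (_∣_)
open import Data.Nat.DivMod using (_/_; m/n*n≡m)
import Data.Nat.Coprimality as Cop
open import Data.Integer as ℤ using ()
import Data.Integer.Properties as ZP
open import Data.Rational as Q using (ℚ; mkℚ; 0ℚ; 1ℚ; _+_; _*_; -_; _-_)
import Data.Rational.Properties as QP
open import Data.Rational.Solver
open import Data.Product using (_×_; _,_)
open import Data.Empty using (⊥-elim)
open import Relation.Nullary using (yes; no)
open import Relation.Binary.PropositionalEquality

open +-*-Solver
module NSol = Data.Nat.Solver.+-*-Solver

qℕ≡mkℚ : ∀ n → qℕ n ≡ mkℚ (ℤ.+ n) 0 (Cop.sym (Cop.1-coprimeTo n))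
qℕ≡mkℚ n = QP.normalize-coprime (Cop.sym (Cop.1-coprimeTo n))

qℕ-+ : ∀ a b → qℕ (a ℕ.+ b) ≡ qℕ a + qℕ b
qℕ-+ a b rewrite qℕ≡mkℚ a | qℕ≡mkℚ b | NP.*-identityʳ a | NP.*-identityʳ b | ZP.+◃n≡+n a | ZP.+◃n≡+n b = refl

qℕ-* : ∀ a b → qℕ (a ℕ.* b) ≡ qℕ a * qℕ b
qℕ-* a b rewrite qℕ≡mkℚ a | qℕ≡mkℚ b | ZP.+◃n≡+n (a ℕ.* b) = refl

qℕ-suc : ∀ n → qℕ (suc n) ≡ 1ℚ + qℕ n
qℕ-suc n = qℕ-+ 1 n

qℕ-∸ : ∀ a b → b ≤ a → qℕ (a ∸ b) ≡ qℕ a - qℕ b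
qℕ-∸ a b b≤a = begin
    qℕ (a ∸ b) ≡⟨ solve 2 (λ x b → x := (b :+ x) :- b) refl (qℕ (a ∸ b)) (qℕ b) ⟩
    (qℕ b + qℕ (a ∸ b)) - qℕ b ≡⟨ cong (_- qℕ b) (trans (sym (qℕ-+ b (a ∸ b))) (cong qℕ (NP.m+[n∸m]≡n b≤a))) ⟩
    qℕ a - qℕ b ∎
  where open ≡-Reasoning

qℕ-suc≢0 : ∀ n → qℕ (suc n) ≢ 0ℚ
qℕ-suc≢0 n eq with trans (sym (qℕ≡mkℚ (suc n))) eq
... | ()

qℕ≢0 : ∀ n → n ≢ 0 → qℕ n ≢ 0ℚ
qℕ≢0 zero h = ⊥-elim (h refl)
qℕ≢0 (suc n) h = qℕ-suc≢0 n

-- inv 0 = 0 (as 1ℚ ÷' 0ℚ = 0ℚ); lemmas that need q ≢ 0ℚ assume it.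
inv : ℚ → ℚ
inv q = 1ℚ ÷' q

÷'≡*inv : ∀ p q → p ÷' q ≡ p * inv q
÷'≡*inv p q with q QP.≟ 0ℚ
... | yes _ = sym (QP.*-zeroʳ p)
... | no q≢0 = cong (p *_) (sym (QP.*-identityˡ _))

*-inv : ∀ q → q ≢ 0ℚ → q * inv q ≡ 1ℚ
*-inv q q≢0 with q QP.≟ 0ℚ
... | yes e = ⊥-elim (q≢0 e)
... | no q≢0' = trans (cong (q *_) (QP.*-identityˡ _)) (QP.*-inverseʳ q {{Q.≢-nonZero q≢0'}})

*≡0⇒≡0 : ∀ p q → p * q ≡ 0ℚ → p ≢ 0ℚ → q ≡ 0ℚ
*≡0⇒≡0 p q e p≢0 = begin
   q ≡⟨ sym (QP.*-identityˡ q) ⟩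
   1ℚ * q ≡⟨ cong (_* q) (sym (*-inv p p≢0)) ⟩
   (p * inv p) * q ≡⟨ solve 3 (λ p q i → (p :* i) :* q := i :* (p :* q)) refl p q (inv p) ⟩
   inv p * (p * q) ≡⟨ cong (inv p *_) e ⟩
   inv p * 0ℚ ≡⟨ QP.*-zeroʳ (inv p) ⟩
   0ℚ ∎
  where open ≡-Reasoning

*≢0 : ∀ p q → p ≢ 0ℚ → q ≢ 0ℚ → p * q ≢ 0ℚ
*≢0 p q p≢0 q≢0 e = q≢0 (*≡0⇒≡0 p q e p≢0)

inv-distrib-* : ∀ p q → inv (p * q) ≡ inv p * inv q
inv-distrib-* p q = h (p QP.≟ 0ℚ) (q QP.≟ 0ℚ)
 where
 h : _ → _ → inv (p * q) ≡ inv p * inv q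
 h (yes e) _ rewrite e = trans (cong inv (QP.*-zeroˡ q)) (sym (QP.*-zeroˡ (inv q)))
 h (no _) (yes e) rewrite e = trans (cong inv (QP.*-zeroʳ p)) (sym (QP.*-zeroʳ (inv p)))
 h (no p≢0) (no q≢0) = begin
    inv (p * q) ≡⟨ solve 1 (λ c → c := con 1ℚ :* con 1ℚ :* c) refl (inv (p * q)) ⟩
    1ℚ * 1ℚ * inv (p * q) ≡⟨ cong₂ (λ x y → x * y * inv (p * q)) (sym (*-inv p p≢0)) (sym (*-inv q q≢0)) ⟩
    ((p * inv p) * (q * inv q)) * inv (p * q) ≡⟨ solve 5 (λ p q a b c → (p :* a) :* (q :* b) :* c := a :* b :* ((p :* q) :* c)) refl p q (inv p) (inv q) (inv (p * q)) ⟩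
    inv p * inv q * ((p * q) * inv (p * q)) ≡⟨ cong (inv p * inv q *_) (*-inv (p * q) (*≢0 p q p≢0 q≢0)) ⟩
    inv p * inv q * 1ℚ ≡⟨ QP.*-identityʳ _ ⟩
    inv p * inv q ∎
  where open ≡-Reasoning

*-cancelʳ : ∀ a b x → x ≢ 0ℚ → a * x ≡ b * x → a ≡ b
*-cancelʳ a b x x≢0 e = begin
  a ≡⟨ sym (QP.*-identityʳ a) ⟩
  a * 1ℚ ≡⟨ cong (a *_) (sym (*-inv x x≢0)) ⟩
  a * (x * inv x) ≡⟨ sym (QP.*-assoc a x (inv x)) ⟩
  (a * x) * inv x ≡⟨ cong (_* inv x) e ⟩
  (b * x) * inv x ≡⟨ QP.*-assoc b x (inv x) ⟩
  b * (x * inv x) ≡⟨ cong (b *_) (*-inv x x≢0) ⟩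
  b * 1ℚ ≡⟨ QP.*-identityʳ b ⟩
  b ∎
  where open ≡-Reasoning

÷'-solve : ∀ p q r → q ≢ 0ℚ → r * q ≡ p → p ÷' q ≡ r
÷'-solve p q r q≢0 e = begin
  p ÷' q ≡⟨ ÷'≡*inv p q ⟩
  p * inv q ≡⟨ cong (_* inv q) (sym e) ⟩
  (r * q) * inv q ≡⟨ QP.*-assoc r q (inv q) ⟩
  r * (q * inv q) ≡⟨ cong (r *_) (*-inv q q≢0) ⟩
  r * 1ℚ ≡⟨ QP.*-identityʳ r ⟩
  r ∎
  where open ≡-Reasoning

inv-solve : ∀ x y z → x ≡ y * z → x ≢ 0ℚ → z ≡ x * inv y
inv-solve x y z e x≢0 = begin
    z ≡⟨ sym (QP.*-identityʳ z) ⟩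
    z * 1ℚ ≡⟨ cong (z *_) (sym (*-inv y y≢0)) ⟩
    z * (y * inv y) ≡⟨ solve 3 (λ z y i → z :* (y :* i) := (y :* z) :* i) refl z y (inv y) ⟩
    (y * z) * inv y ≡⟨ cong (_* inv y) (sym e) ⟩
    x * inv y ∎
  where
  open ≡-Reasoning
  y≢0 : y ≢ 0ℚ
  y≢0 y≡0 = x≢0 (trans e (trans (cong (_* z) y≡0) (QP.*-zeroˡ z)))

inv-inv : ∀ x → inv (inv x) ≡ x
inv-inv x = h (x QP.≟ 0ℚ)
  where
  h : _ → inv (inv x) ≡ x
  h (yes e) rewrite e = refl
  h (no x≢0) = sym (trans (inv-solve 1ℚ (inv x) x (sym (trans (QP.*-comm (inv x) x) (*-inv x x≢0))) (λ ())) (QP.*-identityˡ _))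

*-≡1ʳ : ∀ M p → p ≡ 1ℚ → M * p ≡ M
*-≡1ʳ M p e = trans (cong (M *_) e) (QP.*-identityʳ M)

drop-*1 : ∀ L R P → L ≡ R * P → P ≡ 1ℚ → L ≡ R
drop-*1 L R P e p = trans e (*-≡1ʳ R P p)

*-≡1 : ∀ {a b} → a ≡ 1ℚ → b ≡ 1ℚ → a * b ≡ 1ℚ
*-≡1 refl refl = refl

+*0 : ∀ a b → a + b * 0ℚ ≡ a
+*0 a b = trans (cong (a +_) (QP.*-zeroʳ b)) (QP.+-identityʳ a)

cong₃ : ∀ (f : ℚ → ℚ → ℚ → ℚ) {a a' b b' c c'} → a ≡ a' → b ≡ b' → c ≡ c' → f a b c ≡ f a' b' c'
cong₃ f refl refl refl = refl

cong₄ : ∀ (f : ℚ → ℚ → ℚ → ℚ → ℚ) {a a' b b' c c' d d'} → a ≡ a' → b ≡ b' → c ≡ c' → d ≡ d' → f a b c d ≡ f a' b' c' d'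
cong₄ f refl refl refl refl = refl

cong₅ : ∀ (f : ℚ → ℚ → ℚ → ℚ → ℚ → ℚ) {a a' b b' c c' d d' e e'} → a ≡ a' → b ≡ b' → c ≡ c' → d ≡ d' → e ≡ e' → f a b c d e ≡ f a' b' c' d' e'
cong₅ f refl refl refl refl refl = refl


^'-+ : ∀ a m n → a ^' (m ℕ.+ n) ≡ a ^' m * a ^' n
^'-+ a zero n = sym (QP.*-identityˡ _)
^'-+ a (suc m) n rewrite ^'-+ a m n = sym (QP.*-assoc a (a ^' m) (a ^' n))

^'-* : ∀ a b n → (a * b) ^' n ≡ a ^' n * b ^' n
^'-* a b zero = refl
^'-* a b (suc n) rewrite ^'-* a b n = solve 4 (λ a b x y → (a :* b) :* (x :* y) := (a :* x) :* (b :* y)) refl a b (a ^' n) (b ^' n)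

1^'≡1 : ∀ n → 1ℚ ^' n ≡ 1ℚ
1^'≡1 zero = refl
1^'≡1 (suc n) rewrite 1^'≡1 n = refl

^'≢0 : ∀ a n → a ≢ 0ℚ → a ^' n ≢ 0ℚ
^'≢0 a zero a≢0 ()
^'≢0 a (suc n) a≢0 = *≢0 a (a ^' n) a≢0 (^'≢0 a n a≢0)

sign : ℕ → ℚ
sign k = (- 1ℚ) ^' k

sign-*-sign : ∀ k → sign k * sign k ≡ 1ℚ
sign-*-sign k = trans (sym (^'-* (- 1ℚ) (- 1ℚ) k)) (1^'≡1 k)

sign-even : ∀ k → sign (k ℕ.+ k) ≡ 1ℚ
sign-even k = trans (^'-+ (- 1ℚ) k k) (sign-*-sign k)

sign≢0 : ∀ k → sign k ≢ 0ℚ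
sign≢0 k = ^'≢0 (- 1ℚ) k (λ ())

inv-sign : ∀ k → inv (sign k) ≡ sign k
inv-sign k = sym (trans (inv-solve 1ℚ (sign k) (sign k) (sym (sign-*-sign k)) (λ ())) (QP.*-identityˡ _))

neg4^' : ∀ k → (- qℕ 4) ^' k ≡ sign k * qℕ 4 ^' k
neg4^' k = ^'-* (- 1ℚ) (qℕ 4) k

¼ : ℚ
¼ = ℤ.+ 1 Q./ 4

neg¼^' : ∀ k → (- ¼) ^' k ≡ sign k * ¼ ^' k
neg¼^' k = ^'-* (- 1ℚ) ¼ k

⅕ : ℚ
⅕ = ℤ.+ 1 Q./ 5

⅘ : ℚ
⅘ = ℤ.+ 4 Q./ 5

⅕^'*5^' : ∀ k → ⅕ ^' k * qℕ 5 ^' k ≡ 1ℚ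
⅕^'*5^' k = trans (sym (^'-* ⅕ (qℕ 5) k)) (1^'≡1 k)

inv-2^'-even : ∀ k → inv (qℕ 2 ^' (k ℕ.+ k)) ≡ ¼ ^' k
inv-2^'-even k = begin
    inv (qℕ 2 ^' (k ℕ.+ k)) ≡⟨ cong inv (trans (^'-+ (qℕ 2) k k) (sym (^'-* (qℕ 2) (qℕ 2) k))) ⟩
    inv (qℕ 4 ^' k) ≡⟨ sym (trans (inv-solve 1ℚ (qℕ 4 ^' k) (¼ ^' k) (sym (trans (QP.*-comm (qℕ 4 ^' k) (¼ ^' k)) (trans (sym (^'-* ¼ (qℕ 4) k)) (1^'≡1 k)))) (λ ())) (QP.*-identityˡ _)) ⟩
    ¼ ^' k ∎
  where open ≡-Reasoning

inv-2^'-even-+ : ∀ k r → inv (qℕ 2 ^' ((k ℕ.+ k) ℕ.+ r)) ≡ ¼ ^' k * inv (qℕ 2 ^' r)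
inv-2^'-even-+ k r = trans (cong inv (^'-+ (qℕ 2) (k ℕ.+ k) r)) (trans (inv-distrib-* (qℕ 2 ^' (k ℕ.+ k)) (qℕ 2 ^' r)) (cong (_* inv (qℕ 2 ^' r)) (inv-2^'-even k)))

2^'÷2^' : ∀ m r → qℕ 2 ^' (2 ℕ.* m ℕ.+ 1) ÷' qℕ 2 ^' ((m ℕ.+ m) ℕ.+ r) ≡ qℕ 2 * inv (qℕ 2 ^' r)
2^'÷2^' m r = ÷'-solve _ _ _ (^'≢0 (qℕ 2) ((m ℕ.+ m) ℕ.+ r) (λ ())) (begin
    qℕ 2 * inv (qℕ 2 ^' r) * qℕ 2 ^' ((m ℕ.+ m) ℕ.+ r)
      ≡⟨ cong (qℕ 2 * inv (qℕ 2 ^' r) *_) (^'-+ (qℕ 2) (m ℕ.+ m) r) ⟩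
    qℕ 2 * inv (qℕ 2 ^' r) * (qℕ 2 ^' (m ℕ.+ m) * qℕ 2 ^' r)
      ≡⟨ drop-*1 _ _ _ (solve 4 (λ t i a b → t :* i :* (a :* b) := (a :* t) :* (b :* i)) refl (qℕ 2) (inv (qℕ 2 ^' r)) (qℕ 2 ^' (m ℕ.+ m)) (qℕ 2 ^' r)) (*-inv (qℕ 2 ^' r) (^'≢0 (qℕ 2) r (λ ()))) ⟩
    qℕ 2 ^' (m ℕ.+ m) * qℕ 2
      ≡⟨ cong (qℕ 2 ^' (m ℕ.+ m) *_) (sym (QP.*-identityʳ (qℕ 2))) ⟩
    qℕ 2 ^' (m ℕ.+ m) * qℕ 2 ^' 1
      ≡⟨ sym (^'-+ (qℕ 2) (m ℕ.+ m) 1) ⟩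
    qℕ 2 ^' ((m ℕ.+ m) ℕ.+ 1)
      ≡⟨ cong (λ z → qℕ 2 ^' (m ℕ.+ z ℕ.+ 1)) (sym (NP.+-identityʳ m)) ⟩
    qℕ 2 ^' (2 ℕ.* m ℕ.+ 1) ∎)
  where open ≡-Reasoning


fact : ℕ → ℚ
fact n = qℕ (n !)

fact≢0 : ∀ n → fact n ≢ 0ℚ
fact≢0 n = qℕ≢0 (n !) (ℕ.≢-nonZero⁻¹ (n !) {{n NP.!≢0}})

fact-suc : ∀ n → fact (suc n) ≡ qℕ (suc n) * fact n
fact-suc n = qℕ-* (suc n) (n !)

poch-+ : ∀ a m n → poch a (m ℕ.+ n) ≡ poch a m * poch (a + qℕ m) n
poch-+ a m zero = trans (cong (poch a) (NP.+-identityʳ m)) (sym (QP.*-identityʳ (poch a m)))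
poch-+ a m (suc n) = trans (cong (poch a) (NP.+-suc m n)) (trans (cong₂ (λ x y → x * (a + y)) (poch-+ a m n) (qℕ-+ m n))
  (solve 5 (λ p q a m n → p :* q :* (a :+ (m :+ n)) := p :* (q :* ((a :+ m) :+ n))) refl (poch a m) (poch (a + qℕ m) n) a (qℕ m) (qℕ n)))

poch-split : ∀ c k s → k ≤ s → poch c s ≡ poch c k * poch (c + qℕ k) (s ∸ k)
poch-split c k s k≤s = trans (cong (poch c) (sym (NP.m+[n∸m]≡n k≤s))) (poch-+ c k (s ∸ k))

poch-prefix≢0 : ∀ c k s → k ≤ s → poch c s ≢ 0ℚ → poch c k ≢ 0ℚ
poch-prefix≢0 c k s k≤s nz e = nz (trans (poch-split c k s k≤s) (trans (cong (_* poch (c + qℕ k) (s ∸ k)) e) (QP.*-zeroˡ (poch (c + qℕ k) (s ∸ k)))))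

poch-suc-shift : ∀ a k → poch a (suc k) ≡ a * poch (a + 1ℚ) k
poch-suc-shift a zero = solve 1 (λ a → con 1ℚ :* (a :+ con 0ℚ) := a :* con 1ℚ) refl a
poch-suc-shift a (suc k) = trans (cong₂ (λ x y → x * (a + y)) (poch-suc-shift a k) (qℕ-suc k)) (
  solve 3 (λ a p k → a :* p :* (a :+ (con 1ℚ :+ k)) := a :* (p :* ((a :+ con 1ℚ) :+ k))) refl a (poch (a + 1ℚ) k) (qℕ k))

poch-suc*fact : ∀ a k → poch (qℕ (suc a)) k * fact a ≡ fact (a ℕ.+ k)
poch-suc*fact a zero = trans (QP.*-identityˡ (fact a)) (cong (λ z → fact z) (sym (NP.+-identityʳ a)))
poch-suc*fact a (suc k) = begin
  poch (qℕ (suc a)) k * (qℕ (suc a) + qℕ k) * fact a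
    ≡⟨ solve 3 (λ p x f → p :* x :* f := x :* (p :* f)) refl (poch (qℕ (suc a)) k) (qℕ (suc a) + qℕ k) (fact a) ⟩
  (qℕ (suc a) + qℕ k) * (poch (qℕ (suc a)) k * fact a)
    ≡⟨ cong₂ _*_ (sym (qℕ-+ (suc a) k)) (poch-suc*fact a k) ⟩
  qℕ (suc (a ℕ.+ k)) * fact (a ℕ.+ k)
    ≡⟨ sym (qℕ-* (suc (a ℕ.+ k)) ((a ℕ.+ k) !)) ⟩
  fact (suc (a ℕ.+ k))
    ≡⟨ cong (λ z → fact z) (sym (NP.+-suc a k)) ⟩
  fact (a ℕ.+ suc k) ∎
  where open ≡-Reasoning

poch-suc≡fact : ∀ a k → poch (qℕ (suc a)) k ≡ fact (a ℕ.+ k) * inv (fact a)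
poch-suc≡fact a k = inv-solve (fact (a ℕ.+ k)) (fact a) (poch (qℕ (suc a)) k) (trans (sym (poch-suc*fact a k)) (QP.*-comm (poch (qℕ (suc a)) k) (fact a))) (fact≢0 (a ℕ.+ k))

poch-+1≡fact : ∀ a k → poch (qℕ (a ℕ.+ 1)) k ≡ fact (a ℕ.+ k) * inv (fact a)
poch-+1≡fact a k = trans (cong (λ z → poch (qℕ z) k) (NP.+-comm a 1)) (poch-suc≡fact a k)

inv-poch-+1 : ∀ r k → inv (poch (qℕ (r ℕ.+ 1)) k) ≡ inv (fact (k ℕ.+ r)) * fact r
inv-poch-+1 r k = begin
    inv (poch (qℕ (r ℕ.+ 1)) k) ≡⟨ cong (λ z → inv (poch (qℕ z) k)) (NP.+-comm r 1) ⟩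
    inv (poch (qℕ (suc r)) k) ≡⟨ cong inv (poch-suc≡fact r k) ⟩
    inv (fact (r ℕ.+ k) * inv (fact r)) ≡⟨ inv-distrib-* (fact (r ℕ.+ k)) (inv (fact r)) ⟩
    inv (fact (r ℕ.+ k)) * inv (inv (fact r)) ≡⟨ cong₂ (λ a b → inv (fact a) * b) (NP.+-comm r k) (inv-inv (fact r)) ⟩
    inv (fact (k ℕ.+ r)) * fact r ∎
  where open ≡-Reasoning

inv-qℕ-suc : ∀ a → inv (qℕ (suc a)) ≡ fact a * inv (fact (suc a))
inv-qℕ-suc a = sym (begin
    fact a * inv (fact (suc a)) ≡⟨ cong (λ z → fact a * inv z) (fact-suc a) ⟩
    fact a * inv (qℕ (suc a) * fact a) ≡⟨ cong (fact a *_) (inv-distrib-* (qℕ (suc a)) (fact a)) ⟩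
    fact a * (inv (qℕ (suc a)) * inv (fact a)) ≡⟨ drop-*1 _ _ _ (solve 3 (λ f q i → f :* (q :* i) := q :* (f :* i)) refl (fact a) (inv (qℕ (suc a))) (inv (fact a))) (*-inv (fact a) (fact≢0 a)) ⟩
    inv (qℕ (suc a)) ∎)
  where open ≡-Reasoning

poch-neg*fact : ∀ k l → poch (- qℕ (k ℕ.+ l)) k * fact l ≡ sign k * fact (k ℕ.+ l)
poch-neg*fact zero l = refl
poch-neg*fact (suc k) l = begin
  poch (- qℕ (suc k ℕ.+ l)) (suc k) * fact l
    ≡⟨ cong (_* fact l) (poch-suc-shift _ k) ⟩
  (- qℕ (suc k ℕ.+ l)) * poch (- qℕ (suc k ℕ.+ l) + 1ℚ) k * fact l
    ≡⟨ cong (λ z → (- qℕ (suc k ℕ.+ l)) * poch z k * fact l) e1 ⟩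
  (- qℕ (suc k ℕ.+ l)) * poch (- qℕ (k ℕ.+ l)) k * fact l
    ≡⟨ QP.*-assoc (- qℕ (suc k ℕ.+ l)) (poch (- qℕ (k ℕ.+ l)) k) (fact l) ⟩
  (- qℕ (suc k ℕ.+ l)) * (poch (- qℕ (k ℕ.+ l)) k * fact l)
    ≡⟨ cong ((- qℕ (suc k ℕ.+ l)) *_) (poch-neg*fact k l) ⟩
  (- qℕ (suc k ℕ.+ l)) * (sign k * fact (k ℕ.+ l))
    ≡⟨ solve 3 (λ n s f → (:- n) :* (s :* f) := (:- con 1ℚ :* s) :* (n :* f)) refl (qℕ (suc k ℕ.+ l)) (sign k) (fact (k ℕ.+ l)) ⟩
  sign (suc k) * (qℕ (suc k ℕ.+ l) * fact (k ℕ.+ l))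
    ≡⟨ cong (sign (suc k) *_) (sym (qℕ-* (suc k ℕ.+ l) ((k ℕ.+ l) !))) ⟩
  sign (suc k) * fact (suc k ℕ.+ l) ∎
  where
  open ≡-Reasoning
  e1 : - qℕ (suc k ℕ.+ l) + 1ℚ ≡ - qℕ (k ℕ.+ l)
  e1 = trans (cong (λ z → - z + 1ℚ) (qℕ-suc (k ℕ.+ l))) (solve 1 (λ x → :- (con 1ℚ :+ x) :+ con 1ℚ := :- x) refl (qℕ (k ℕ.+ l)))

poch-neg≡fact : ∀ k l → poch (- qℕ (k ℕ.+ l)) k ≡ sign k * fact (k ℕ.+ l) * inv (fact l)
poch-neg≡fact k l = inv-solve (sign k * fact (k ℕ.+ l)) (fact l) (poch (- qℕ (k ℕ.+ l)) k) (trans (sym (poch-neg*fact k l)) (QP.*-comm (poch (- qℕ (k ℕ.+ l)) k) (fact l))) (*≢0 _ _ (sign≢0 k) (fact≢0 (k ℕ.+ l)))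

poch-neg≢0 : ∀ k l → poch (- qℕ (k ℕ.+ l)) k ≢ 0ℚ
poch-neg≢0 k l e = *≢0 _ _ (sign≢0 k) (fact≢0 (k ℕ.+ l)) (trans (sym (poch-neg*fact k l)) (trans (cong (_* fact l) e) (QP.*-zeroˡ (fact l))))

inv-poch-neg : ∀ k l → inv (poch (- qℕ (k ℕ.+ l)) k) ≡ sign k * inv (fact (k ℕ.+ l)) * fact l
inv-poch-neg k l = begin
    inv (poch (- qℕ (k ℕ.+ l)) k) ≡⟨ cong inv (poch-neg≡fact k l) ⟩
    inv (sign k * fact (k ℕ.+ l) * inv (fact l)) ≡⟨ trans (inv-distrib-* (sign k * fact (k ℕ.+ l)) (inv (fact l))) (cong₂ _*_ (inv-distrib-* (sign k) (fact (k ℕ.+ l))) (inv-inv (fact l))) ⟩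
    inv (sign k) * inv (fact (k ℕ.+ l)) * fact l ≡⟨ cong (λ z → z * inv (fact (k ℕ.+ l)) * fact l) (inv-sign k) ⟩
    sign k * inv (fact (k ℕ.+ l)) * fact l ∎
  where open ≡-Reasoning

poch-duplication : ∀ j k → poch (- (qℕ j * half)) k * poch ((1ℚ - qℕ j) * half) k * qℕ 4 ^' k ≡ poch (- qℕ j) (k ℕ.+ k)
poch-duplication j zero = refl
poch-duplication j (suc k) = begin
    poch h1 k * (h1 + qℕ k) * (poch h2 k * (h2 + qℕ k)) * (qℕ 4 * qℕ 4 ^' k)
      ≡⟨ solve 6 (λ p a q b c f → p :* a :* (q :* b) :* (c :* f) := (p :* q :* f) :* (a :* b :* c)) refl (poch h1 k) (h1 + qℕ k) (poch h2 k) (h2 + qℕ k) (qℕ 4) (qℕ 4 ^' k) ⟩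
    (poch h1 k * poch h2 k * qℕ 4 ^' k) * ((h1 + qℕ k) * (h2 + qℕ k) * qℕ 4)
      ≡⟨ cong₂ _*_ (poch-duplication j k) eXY ⟩
    poch (- qℕ j) (k ℕ.+ k) * ((- qℕ j + qℕ (k ℕ.+ k)) * (- qℕ j + qℕ (suc (k ℕ.+ k))))
      ≡⟨ sym (QP.*-assoc (poch (- qℕ j) (k ℕ.+ k)) (- qℕ j + qℕ (k ℕ.+ k)) (- qℕ j + qℕ (suc (k ℕ.+ k)))) ⟩
    poch (- qℕ j) (suc (suc (k ℕ.+ k)))
      ≡⟨ cong (λ z → poch (- qℕ j) (suc z)) (sym (NP.+-suc k k)) ⟩
    poch (- qℕ j) (suc k ℕ.+ suc k) ∎
  where
  open ≡-Reasoning
  h1 = - (qℕ j * half)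
  h2 = (1ℚ - qℕ j) * half
  eXY : (h1 + qℕ k) * (h2 + qℕ k) * qℕ 4 ≡ (- qℕ j + qℕ (k ℕ.+ k)) * (- qℕ j + qℕ (suc (k ℕ.+ k)))
  eXY = trans (solve 2 (λ j k → (:- (j :* con half) :+ k) :* ((con 1ℚ :- j) :* con half :+ k) :* con (qℕ 4) := (:- j :+ (k :+ k)) :* (:- j :+ (con 1ℚ :+ (k :+ k)))) refl (qℕ j) (qℕ k))
              (sym (cong₂ (λ a b → (- qℕ j + a) * (- qℕ j + b)) (qℕ-+ k k) (trans (qℕ-suc (k ℕ.+ k)) (cong (1ℚ +_) (qℕ-+ k k)))))

poch-3/2 : ∀ k → poch (ℤ.+ 3 Q./ 2) k * fact k * qℕ 4 ^' k ≡ fact (suc (k ℕ.+ k))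
poch-3/2 zero = refl
poch-3/2 (suc k) = begin
    poch c k * (c + qℕ k) * qℕ (suc k ℕ.* k !) * (qℕ 4 * qℕ 4 ^' k)
      ≡⟨ cong (λ z → poch c k * (c + qℕ k) * z * (qℕ 4 * qℕ 4 ^' k)) (qℕ-* (suc k) (k !)) ⟩
    poch c k * (c + qℕ k) * (qℕ (suc k) * fact k) * (qℕ 4 * qℕ 4 ^' k)
      ≡⟨ solve 6 (λ p a s f four g → p :* a :* (s :* f) :* (four :* g) := (p :* f :* g) :* (a :* s :* four)) refl (poch c k) (c + qℕ k) (qℕ (suc k)) (fact k) (qℕ 4) (qℕ 4 ^' k) ⟩
    (poch c k * fact k * qℕ 4 ^' k) * ((c + qℕ k) * qℕ (suc k) * qℕ 4)
      ≡⟨ cong₂ _*_ (poch-3/2 k) eX ⟩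
    fact (suc (k ℕ.+ k)) * (qℕ (suc (suc (suc (k ℕ.+ k)))) * qℕ (suc (suc (k ℕ.+ k))))
      ≡⟨ solve 3 (λ f a b → f :* (a :* b) := a :* (b :* f)) refl (fact (suc (k ℕ.+ k))) (qℕ (suc (suc (suc (k ℕ.+ k))))) (qℕ (suc (suc (k ℕ.+ k)))) ⟩
    qℕ (suc (suc (suc (k ℕ.+ k)))) * (qℕ (suc (suc (k ℕ.+ k))) * fact (suc (k ℕ.+ k)))
      ≡⟨ cong (qℕ (suc (suc (suc (k ℕ.+ k)))) *_) (sym (qℕ-* (suc (suc (k ℕ.+ k))) (suc (k ℕ.+ k) !))) ⟩
    qℕ (suc (suc (suc (k ℕ.+ k)))) * fact (suc (suc (k ℕ.+ k)))
      ≡⟨ sym (qℕ-* (suc (suc (suc (k ℕ.+ k)))) (suc (suc (k ℕ.+ k)) !)) ⟩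
    fact (suc (suc (suc (k ℕ.+ k))))
      ≡⟨ cong (λ z → fact (suc (suc z))) (sym (NP.+-suc k k)) ⟩
    fact (suc (suc k ℕ.+ suc k)) ∎
  where
  open ≡-Reasoning
  c = ℤ.+ 3 Q./ 2
  e3 : qℕ (suc (suc (suc (k ℕ.+ k)))) ≡ 1ℚ + (1ℚ + (1ℚ + (qℕ k + qℕ k)))
  e3 = trans (qℕ-suc (suc (suc (k ℕ.+ k)))) (cong (1ℚ +_) (trans (qℕ-suc (suc (k ℕ.+ k))) (cong (1ℚ +_) (trans (qℕ-suc (k ℕ.+ k)) (cong (1ℚ +_) (qℕ-+ k k))))))
  e2 : qℕ (suc (suc (k ℕ.+ k))) ≡ 1ℚ + (1ℚ + (qℕ k + qℕ k))
  e2 = trans (qℕ-suc (suc (k ℕ.+ k))) (cong (1ℚ +_) (trans (qℕ-suc (k ℕ.+ k)) (cong (1ℚ +_) (qℕ-+ k k))))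
  eX : (c + qℕ k) * qℕ (suc k) * qℕ 4 ≡ qℕ (suc (suc (suc (k ℕ.+ k)))) * qℕ (suc (suc (k ℕ.+ k)))
  eX = trans (cong (λ z → (c + qℕ k) * z * qℕ 4) (qℕ-suc k))
        (trans (solve 1 (λ k → (con c :+ k) :* (con 1ℚ :+ k) :* con (qℕ 4) := (con 1ℚ :+ (con 1ℚ :+ (con 1ℚ :+ (k :+ k)))) :* (con 1ℚ :+ (con 1ℚ :+ (k :+ k)))) refl (qℕ k))
          (sym (cong₂ _*_ e3 e2)))


sum-cong : ∀ N {f g : ℕ → ℚ} → (∀ k → k ≤ N → f k ≡ g k) → sumTo N f ≡ sumTo N g
sum-cong zero h = h 0 z≤n
sum-cong (suc N) h = cong₂ _+_ (sum-cong N (λ k k≤ → h k (NP.m≤n⇒m≤1+n k≤))) (h (suc N) NP.≤-refl)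

sum-+ : ∀ N (f g : ℕ → ℚ) → sumTo N (λ k → f k + g k) ≡ sumTo N f + sumTo N g
sum-+ zero f g = refl
sum-+ (suc N) f g rewrite sum-+ N f g =
  solve 4 (λ a b c d → a :+ b :+ (c :+ d) := a :+ c :+ (b :+ d)) refl (sumTo N f) (sumTo N g) (f (suc N)) (g (suc N))

sum-*ˡ : ∀ N c (f : ℕ → ℚ) → sumTo N (λ k → c * f k) ≡ c * sumTo N f
sum-*ˡ zero c f = refl
sum-*ˡ (suc N) c f rewrite sum-*ˡ N c f = sym (QP.*-distribˡ-+ c (sumTo N f) (f (suc N)))

sum-shift : ∀ N (f : ℕ → ℚ) → sumTo (suc N) f ≡ f 0 + sumTo N (λ k → f (suc k))
sum-shift zero f = refl
sum-shift (suc N) f rewrite sum-shift N f = QP.+-assoc (f 0) (sumTo N (λ k → f (suc k))) (f (suc (suc N)))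

sum-zero-tail : ∀ N d (f : ℕ → ℚ) → (∀ k → N < k → k ≤ N ℕ.+ d → f k ≡ 0ℚ) → sumTo (N ℕ.+ d) f ≡ sumTo N f
sum-zero-tail N zero f h rewrite NP.+-identityʳ N = refl
sum-zero-tail N (suc d) f h rewrite NP.+-suc N d =
  begin
    sumTo (N ℕ.+ d) f + f (suc (N ℕ.+ d))
      ≡⟨ cong₂ _+_ (sum-zero-tail N d f (λ k a b → h k a (NP.≤-trans b (NP.n≤1+n _)))) (h (suc (N ℕ.+ d)) (s≤s (NP.m≤m+n N d)) NP.≤-refl) ⟩
    sumTo N f + 0ℚ ≡⟨ QP.+-identityʳ (sumTo N f) ⟩
    sumTo N f ∎
  where open ≡-Reasoning

sum-zero-tail′ : ∀ N M (f : ℕ → ℚ) → N ≤ M → (∀ k → N < k → k ≤ M → f k ≡ 0ℚ) → sumTo M f ≡ sumTo N f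
sum-zero-tail′ N M f N≤M h = trans (cong (λ z → sumTo z f) (sym e)) (sum-zero-tail N (M ∸ N) f (λ k a b → h k a (NP.≤-trans b (NP.≤-reflexive e))))
  where e = NP.m+[n∸m]≡n N≤M

sum-swap : ∀ N M (f : ℕ → ℕ → ℚ) → sumTo N (λ a → sumTo M (λ b → f a b)) ≡ sumTo M (λ b → sumTo N (λ a → f a b))
sum-swap zero M f = refl
sum-swap (suc N) M f rewrite sum-swap N M f = sym (sum-+ M (λ b → sumTo N (λ a → f a b)) (λ b → f (suc N) b))

sum-triangle : ∀ H (f : ℕ → ℕ → ℚ) → sumTo H (λ m → sumTo m (λ k → f m k)) ≡ sumTo H (λ k → sumTo (H ∸ k) (λ l → f (k ℕ.+ l) k))
sum-triangle zero f = refl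
sum-triangle (suc H) f = begin
    sumTo H (λ m → sumTo m (λ k → f m k)) + sumTo (suc H) (λ k → f (suc H) k)
      ≡⟨ cong (_+ sumTo (suc H) (λ k → f (suc H) k)) (sum-triangle H f) ⟩
    sumTo H (λ k → sumTo (H ∸ k) (λ l → f (k ℕ.+ l) k)) + (sumTo H (λ k → f (suc H) k) + f (suc H) (suc H))
      ≡⟨ sym (QP.+-assoc (sumTo H (λ k → sumTo (H ∸ k) (λ l → f (k ℕ.+ l) k))) (sumTo H (λ k → f (suc H) k)) (f (suc H) (suc H))) ⟩
    sumTo H (λ k → sumTo (H ∸ k) (λ l → f (k ℕ.+ l) k)) + sumTo H (λ k → f (suc H) k) + f (suc H) (suc H)
      ≡⟨ cong₂ _+_ (sym (sum-+ H (λ k → sumTo (H ∸ k) (λ l → f (k ℕ.+ l) k)) (λ k → f (suc H) k))) (cong (λ z → f z (suc H)) (sym (NP.+-identityʳ (suc H)))) ⟩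
    sumTo H (λ k → sumTo (H ∸ k) (λ l → f (k ℕ.+ l) k) + f (suc H) k) + f (suc H ℕ.+ 0) (suc H)
      ≡⟨ cong (_+ f (suc H ℕ.+ 0) (suc H)) (sum-cong H λ k k≤H → step k k≤H) ⟩
    sumTo H (λ k → sumTo (suc H ∸ k) (λ l → f (k ℕ.+ l) k)) + f (suc H ℕ.+ 0) (suc H)
      ≡⟨ cong (λ z → sumTo H (λ k → sumTo (suc H ∸ k) (λ l → f (k ℕ.+ l) k)) + sumTo z (λ l → f (suc H ℕ.+ l) (suc H))) (sym (NP.n∸n≡0 H)) ⟩
    sumTo H (λ k → sumTo (suc H ∸ k) (λ l → f (k ℕ.+ l) k)) + sumTo (H ∸ H) (λ l → f (suc H ℕ.+ l) (suc H)) ∎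
  where
  open ≡-Reasoning
  step : ∀ k → k ≤ H → sumTo (H ∸ k) (λ l → f (k ℕ.+ l) k) + f (suc H) k ≡ sumTo (suc H ∸ k) (λ l → f (k ℕ.+ l) k)
  step k k≤H rewrite NP.+-∸-assoc 1 k≤H = cong (λ z → sumTo (H ∸ k) (λ l → f (k ℕ.+ l) k) + f z k) e
    where
    e : suc H ≡ k ℕ.+ suc (H ∸ k)
    e = trans (cong suc (sym (NP.m+[n∸m]≡n k≤H))) (sym (NP.+-suc k (H ∸ k)))

sum-reverse : ∀ N (f : ℕ → ℚ) → sumTo N f ≡ sumTo N (λ k → f (N ∸ k))
sum-reverse zero f = refl
sum-reverse (suc N) f = begin
    sumTo (suc N) f ≡⟨ sum-shift N f ⟩
    f 0 + sumTo N (λ k → f (suc k)) ≡⟨ cong (λ z → f 0 + z) (sum-reverse N (λ k → f (suc k))) ⟩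
    f 0 + sumTo N (λ k → f (suc (N ∸ k))) ≡⟨ QP.+-comm (f 0) _ ⟩
    sumTo N (λ k → f (suc (N ∸ k))) + f 0 ≡⟨ cong₂ _+_ (sum-cong N (λ k k≤ → cong f (sym (NP.+-∸-assoc 1 k≤)))) (cong f (sym (NP.n∸n≡0 N))) ⟩
    sumTo N (λ k → f (suc N ∸ k)) + f (suc N ∸ suc N) ∎
  where open ≡-Reasoning

sum-antidiagonal : ∀ H (f : ℕ → ℕ → ℚ) → sumTo H (λ m → sumTo m (λ k → f m k)) ≡ sumTo H (λ i → sumTo (H ∸ i) (λ k → f (i ℕ.+ k) k))
sum-antidiagonal H f = begin
    sumTo H (λ m → sumTo m (λ k → f m k)) ≡⟨ sum-cong H (λ m _ → sum-reverse m (λ k → f m k)) ⟩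
    sumTo H (λ m → sumTo m (λ k → f m (m ∸ k))) ≡⟨ sum-triangle H (λ m k → f m (m ∸ k)) ⟩
    sumTo H (λ i → sumTo (H ∸ i) (λ k → f (i ℕ.+ k) (i ℕ.+ k ∸ i))) ≡⟨ sum-cong H (λ i _ → sum-cong (H ∸ i) (λ k _ → cong (f (i ℕ.+ k)) (NP.m+n∸m≡n i k))) ⟩
    sumTo H (λ i → sumTo (H ∸ i) (λ k → f (i ℕ.+ k) k)) ∎
  where open ≡-Reasoning

-- weight n = 2 / c_n: pairing k with n - k counts every term twice except a central one.
weight : ℕ → ℚ
weight zero = 1ℚ
weight (suc _) = qℕ 2

weight-index : ∀ n k → suc (suc n) ∸ 2 ℕ.* suc k ≡ n ∸ 2 ℕ.* k
weight-index n k rewrite NP.+-suc k (k ℕ.+ 0) = refl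

sum-palindrome : ∀ n (g : ℕ → ℚ) → (∀ k → k ≤ n → g k ≡ g (n ∸ k)) → sumTo n g ≡ sumTo ⌊ n /2⌋ (λ k → g k * weight (n ∸ 2 ℕ.* k))
sum-palindrome zero g h = sym (QP.*-identityʳ (g 0))
sum-palindrome (suc zero) g h rewrite sym (h 1 (s≤s z≤n)) = solve 1 (λ x → x :+ x := x :* con (qℕ 2)) refl (g 1)
sum-palindrome (suc (suc n)) g h = begin
    sumTo (suc n) g + g (suc (suc n)) ≡⟨ cong₂ _+_ (sum-shift n g) (sym (h 0 z≤n)) ⟩
    g 0 + sumTo n (λ k → g (suc k)) + g 0 ≡⟨ cong (λ z → g 0 + z + g 0) (sum-palindrome n (λ k → g (suc k)) h') ⟩
    g 0 + S + g 0 ≡⟨ solve 2 (λ a s → a :+ s :+ a := a :* con (qℕ 2) :+ s) refl (g 0) S ⟩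
    g 0 * qℕ 2 + S ≡⟨ cong (λ z → g 0 * qℕ 2 + z) (sum-cong ⌊ n /2⌋ (λ k _ → cong (λ z → g (suc k) * weight z) (sym (weight-index n k)))) ⟩
    g 0 * qℕ 2 + sumTo ⌊ n /2⌋ (λ k → g (suc k) * weight (suc (suc n) ∸ 2 ℕ.* suc k)) ≡⟨ sym (sum-shift ⌊ n /2⌋ (λ k → g k * weight (suc (suc n) ∸ 2 ℕ.* k))) ⟩
    sumTo (suc ⌊ n /2⌋) (λ k → g k * weight (suc (suc n) ∸ 2 ℕ.* k)) ∎
  where
  open ≡-Reasoning
  S = sumTo ⌊ n /2⌋ (λ k → g (suc k) * weight (n ∸ 2 ℕ.* k))
  h' : ∀ k → k ≤ n → g (suc k) ≡ g (suc (n ∸ k))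
  h' k k≤n = trans (h (suc k) (s≤s (NP.m≤n⇒m≤1+n k≤n))) (cong g (NP.+-∸-assoc 1 k≤n))


2*≡+ : ∀ i → 2 ℕ.* i ≡ i ℕ.+ i
2*≡+ i = cong (i ℕ.+_) (NP.+-identityʳ i)

⌊/2⌋+⌊/2⌋≤ : ∀ j → ⌊ j /2⌋ ℕ.+ ⌊ j /2⌋ ≤ j
⌊/2⌋+⌊/2⌋≤ zero = z≤n
⌊/2⌋+⌊/2⌋≤ (suc zero) = z≤n
⌊/2⌋+⌊/2⌋≤ (suc (suc j)) rewrite NP.+-suc ⌊ j /2⌋ ⌊ j /2⌋ = s≤s (s≤s (⌊/2⌋+⌊/2⌋≤ j))

≤⌊/2⌋⇒+≤ : ∀ j k → k ≤ ⌊ j /2⌋ → k ℕ.+ k ≤ j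
≤⌊/2⌋⇒+≤ j k k≤h = NP.≤-trans (NP.+-mono-≤ k≤h k≤h) (⌊/2⌋+⌊/2⌋≤ j)

+≤⇒≤⌊/2⌋ : ∀ j k → k ℕ.+ k ≤ j → k ≤ ⌊ j /2⌋
+≤⇒≤⌊/2⌋ j zero _ = z≤n
+≤⇒≤⌊/2⌋ (suc (suc j)) (suc k) (s≤s le) rewrite NP.+-suc k k with le
... | s≤s le' = s≤s (+≤⇒≤⌊/2⌋ j k le')
+≤⇒≤⌊/2⌋ (suc zero) (suc k) (s≤s le) rewrite NP.+-suc k k with le
... | ()
+≤⇒≤⌊/2⌋ zero (suc k) ()

⌊+/2⌋ : ∀ i n → ⌊ (i ℕ.+ i) ℕ.+ n /2⌋ ≡ i ℕ.+ ⌊ n /2⌋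
⌊+/2⌋ zero n = refl
⌊+/2⌋ (suc i) n rewrite NP.+-suc i i = cong suc (⌊+/2⌋ i n)

m+m+r∸2m≡r : ∀ m r → (m ℕ.+ m) ℕ.+ r ∸ 2 ℕ.* m ≡ r
m+m+r∸2m≡r m r = trans (cong ((m ℕ.+ m) ℕ.+ r ∸_) (2*≡+ m)) (NP.m+n∸m≡n (m ℕ.+ m) r)

m+m+r∸m≡m+r : ∀ m r → (m ℕ.+ m) ℕ.+ r ∸ m ≡ m ℕ.+ r
m+m+r∸m≡m+r m r = trans (cong (_∸ m) (NP.+-assoc m m r)) (NP.m+n∸m≡n m (m ℕ.+ r))

⌊/2⌋∸ : ∀ j i → i ≤ ⌊ j /2⌋ → ⌊ j /2⌋ ∸ i ≡ ⌊ (j ∸ 2 ℕ.* i) /2⌋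
⌊/2⌋∸ j i i≤h = begin
    ⌊ j /2⌋ ∸ i ≡⟨ cong (λ z → ⌊ z /2⌋ ∸ i) (sym e) ⟩
    ⌊ (i ℕ.+ i) ℕ.+ n /2⌋ ∸ i ≡⟨ cong (_∸ i) (⌊+/2⌋ i n) ⟩
    i ℕ.+ ⌊ n /2⌋ ∸ i ≡⟨ NP.m+n∸m≡n i ⌊ n /2⌋ ⟩
    ⌊ n /2⌋ ≡⟨ cong ⌊_/2⌋ (cong (j ∸_) (sym (2*≡+ i))) ⟩
    ⌊ (j ∸ 2 ℕ.* i) /2⌋ ∎
  where
  open ≡-Reasoning
  n = j ∸ (i ℕ.+ i)
  e = NP.m+[n∸m]≡n (≤⌊/2⌋⇒+≤ j i i≤h)

∸< : ∀ j k → j < k ℕ.+ k → j ∸ k < k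
∸< j k lt with k NP.≤? j
... | yes k≤j = NP.+-cancelˡ-< k (j ∸ k) k (subst (_< k ℕ.+ k) (sym (NP.m+[n∸m]≡n k≤j)) lt)
... | no k≰j = subst (_< k) (sym (NP.m≤n⇒m∸n≡0 (NP.<⇒≤ (NP.≰⇒> k≰j)))) (NP.≤-<-trans z≤n (NP.≰⇒> k≰j))

⌊/2⌋<⇒<+ : ∀ j k → ⌊ j /2⌋ < k → j < k ℕ.+ k
⌊/2⌋<⇒<+ j k lt = NP.≰⇒> (λ le → NP.<⇒≱ lt (+≤⇒≤⌊/2⌋ j k le))


qC : ℕ → ℕ → ℚ
qC n k = qℕ (n C k)

qC-pascal : ∀ n k → qC (suc n) (suc k) ≡ qC n k + qC n (suc k)
qC-pascal n k = trans (cong qℕ (sym (NC.nCk+nC[k+1]≡[n+1]C[k+1] n k))) (qℕ-+ (n C k) (n C suc k))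

qC-> : ∀ n k → n < k → qC n k ≡ 0ℚ
qC-> n k n<k = cong qℕ (NC.k>n⇒nCk≡0 n<k)

C*!*!≡! : ∀ a b → ((a ℕ.+ b) C a) ℕ.* (a ! ℕ.* b !) ≡ (a ℕ.+ b) !
C*!*!≡! a b = begin
    ((a ℕ.+ b) C a) ℕ.* (a ! ℕ.* b !)
      ≡⟨ cong (λ z → z ℕ.* (a ! ℕ.* b !)) (NC.nCk≡n!/k![n-k]! (NP.m≤m+n a b)) ⟩
    ((a ℕ.+ b) ! / (a ! ℕ.* (a ℕ.+ b ∸ a) !)) {{a NP.!* (a ℕ.+ b ∸ a) !≢0}} ℕ.* (a ! ℕ.* b !)
      ≡⟨ cong (λ z → ((a ℕ.+ b) ! / (a ! ℕ.* z !)) {{a NP.!* z !≢0}} ℕ.* (a ! ℕ.* b !)) (NP.m+n∸m≡n a b) ⟩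
    ((a ℕ.+ b) ! / (a ! ℕ.* b !)) {{a NP.!* b !≢0}} ℕ.* (a ! ℕ.* b !)
      ≡⟨ m/n*n≡m {{a NP.!* b !≢0}} (subst (λ z → a ! ℕ.* z ! ∣ (a ℕ.+ b) !) (NP.m+n∸m≡n a b) (NC.k![n∸k]!∣n! (NP.m≤m+n a b))) ⟩
    (a ℕ.+ b) ! ∎
  where open ≡-Reasoning

qC*fact*fact : ∀ a b → qC (a ℕ.+ b) a * (fact a * fact b) ≡ fact (a ℕ.+ b)
qC*fact*fact a b = trans (cong (qC (a ℕ.+ b) a *_) (sym (qℕ-* (a !) (b !)))) (trans (sym (qℕ-* ((a ℕ.+ b) C a) (a ! ℕ.* b !))) (cong qℕ (C*!*!≡! a b)))

qC≡fact : ∀ a b → qC (a ℕ.+ b) a ≡ fact (a ℕ.+ b) * inv (fact a) * inv (fact b)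
qC≡fact a b = begin
    qC (a ℕ.+ b) a ≡⟨ inv-solve (fact (a ℕ.+ b)) (fact a * fact b) (qC (a ℕ.+ b) a) (trans (sym (qC*fact*fact a b)) (QP.*-comm (qC (a ℕ.+ b) a) (fact a * fact b))) (fact≢0 (a ℕ.+ b)) ⟩
    fact (a ℕ.+ b) * inv (fact a * fact b) ≡⟨ cong (fact (a ℕ.+ b) *_) (inv-distrib-* (fact a) (fact b)) ⟩
    fact (a ℕ.+ b) * (inv (fact a) * inv (fact b)) ≡⟨ sym (QP.*-assoc (fact (a ℕ.+ b)) (inv (fact a)) (inv (fact b))) ⟩
    fact (a ℕ.+ b) * inv (fact a) * inv (fact b) ∎
  where open ≡-Reasoning

qC≡fact′ : ∀ a b → qC (a ℕ.+ b) b ≡ fact (a ℕ.+ b) * inv (fact a) * inv (fact b)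
qC≡fact′ a b = begin
    qC (a ℕ.+ b) b ≡⟨ cong (λ z → qC z b) (NP.+-comm a b) ⟩
    qC (b ℕ.+ a) b ≡⟨ qC≡fact b a ⟩
    fact (b ℕ.+ a) * inv (fact b) * inv (fact a) ≡⟨ cong (λ z → fact z * inv (fact b) * inv (fact a)) (NP.+-comm b a) ⟩
    fact (a ℕ.+ b) * inv (fact b) * inv (fact a) ≡⟨ solve 3 (λ x y z → x :* y :* z := x :* z :* y) refl (fact (a ℕ.+ b)) (inv (fact b)) (inv (fact a)) ⟩
    fact (a ℕ.+ b) * inv (fact a) * inv (fact b) ∎
  where open ≡-Reasoning

pascal-sum : ∀ N (F : ℕ → ℚ) → sumTo (suc N) (λ l → qC (suc N) l * F l) ≡ sumTo N (λ l → qC N l * F l) + sumTo N (λ l → qC N l * F (suc l))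
pascal-sum N F = begin
    sumTo (suc N) (λ l → qC (suc N) l * F l)
      ≡⟨ sum-shift N (λ l → qC (suc N) l * F l) ⟩
    1ℚ * F 0 + sumTo N (λ l → qC (suc N) (suc l) * F (suc l))
      ≡⟨ cong (λ z → 1ℚ * F 0 + z) (sum-cong N (λ l _ → trans (cong (_* F (suc l)) (qC-pascal N l)) (QP.*-distribʳ-+ (F (suc l)) (qC N l) (qC N (suc l))))) ⟩
    1ℚ * F 0 + sumTo N (λ l → qC N l * F (suc l) + qC N (suc l) * F (suc l))
      ≡⟨ cong (λ z → 1ℚ * F 0 + z) (sum-+ N (λ l → qC N l * F (suc l)) (λ l → qC N (suc l) * F (suc l))) ⟩
    1ℚ * F 0 + (A + B)
      ≡⟨ solve 3 (λ x a b → x :+ (a :+ b) := (x :+ b) :+ a) refl (1ℚ * F 0) A B ⟩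
    (1ℚ * F 0 + B) + A
      ≡⟨ cong (_+ A) (sym (sum-shift N (λ l → qC N l * F l))) ⟩
    sumTo (suc N) (λ l → qC N l * F l) + A
      ≡⟨ cong (_+ A) e ⟩
    sumTo N (λ l → qC N l * F l) + A ∎
  where
  open ≡-Reasoning
  A = sumTo N (λ l → qC N l * F (suc l))
  B = sumTo N (λ l → qC N (suc l) * F (suc l))
  e : sumTo (suc N) (λ l → qC N l * F l) ≡ sumTo N (λ l → qC N l * F l)
  e = trans (cong (sumTo N (λ l → qC N l * F l) +_) (trans (cong (_* F (suc N)) (qC-> N (suc N) NP.≤-refl)) (QP.*-zeroˡ (F (suc N))))) (QP.+-identityʳ _)

binomial-theorem : ∀ n x → sumTo n (λ k → qC n k * x ^' k) ≡ (1ℚ + x) ^' n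
binomial-theorem zero x = refl
binomial-theorem (suc n) x = begin
    sumTo (suc n) (λ k → qC (suc n) k * x ^' k)
      ≡⟨ pascal-sum n (λ k → x ^' k) ⟩
    sumTo n (λ k → qC n k * x ^' k) + sumTo n (λ k → qC n k * (x * x ^' k))
      ≡⟨ cong (λ z → sumTo n (λ k → qC n k * x ^' k) + z) (trans (sum-cong n (λ k _ → solve 3 (λ c x p → c :* (x :* p) := x :* (c :* p)) refl (qC n k) x (x ^' k))) (sum-*ˡ n x (λ k → qC n k * x ^' k))) ⟩
    S + x * S
      ≡⟨ cong (λ z → z + x * z) (binomial-theorem n x) ⟩
    (1ℚ + x) ^' n + x * (1ℚ + x) ^' n
      ≡⟨ solve 2 (λ p x → p :+ x :* p := (con 1ℚ :+ x) :* p) refl ((1ℚ + x) ^' n) x ⟩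
    (1ℚ + x) ^' suc n ∎
  where
  open ≡-Reasoning
  S = sumTo n (λ k → qC n k * x ^' k)

sum-qC : ∀ n → sumTo n (λ k → qC n k) ≡ qℕ 2 ^' n
sum-qC n = trans (sum-cong n (λ k _ → trans (sym (QP.*-identityʳ (qC n k))) (cong (qC n k *_) (sym (1^'≡1 k))))) (binomial-theorem n 1ℚ)

sum-qC-palindrome : ∀ n → sumTo ⌊ n /2⌋ (λ k → qC n k * weight (n ∸ 2 ℕ.* k)) ≡ qℕ 2 ^' n
sum-qC-palindrome n = trans (sym (sum-palindrome n (qC n) (λ k k≤n → cong qℕ (NC.nCk≡nC[n∸k] k≤n)))) (sum-qC n)

sq : ℚ → ℚ
sq y = y * y

sum-qC*sq : ∀ N → sumTo N (λ l → qC N l * sq (qℕ N - qℕ 2 * qℕ l)) ≡ qℕ N * qℕ 2 ^' N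
sum-qC*sq zero = refl
sum-qC*sq (suc N) = begin
    sumTo (suc N) (λ l → qC (suc N) l * sq (qℕ (suc N) - qℕ 2 * qℕ l))
      ≡⟨ pascal-sum N (λ l → sq (qℕ (suc N) - qℕ 2 * qℕ l)) ⟩
    sumTo N (λ l → qC N l * sq (qℕ (suc N) - qℕ 2 * qℕ l)) + sumTo N (λ l → qC N l * sq (qℕ (suc N) - qℕ 2 * qℕ (suc l)))
      ≡⟨ sym (sum-+ N _ _) ⟩
    sumTo N (λ l → qC N l * sq (qℕ (suc N) - qℕ 2 * qℕ l) + qC N l * sq (qℕ (suc N) - qℕ 2 * qℕ (suc l)))
      ≡⟨ sum-cong N (λ l _ → summand l) ⟩
    sumTo N (λ l → qℕ 2 * (qC N l * sq (qℕ N - qℕ 2 * qℕ l)) + qℕ 2 * qC N l)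
      ≡⟨ sum-+ N _ _ ⟩
    sumTo N (λ l → qℕ 2 * (qC N l * sq (qℕ N - qℕ 2 * qℕ l))) + sumTo N (λ l → qℕ 2 * qC N l)
      ≡⟨ cong₂ _+_ (sum-*ˡ N (qℕ 2) _) (sum-*ˡ N (qℕ 2) _) ⟩
    qℕ 2 * sumTo N (λ l → qC N l * sq (qℕ N - qℕ 2 * qℕ l)) + qℕ 2 * sumTo N (λ l → qC N l)
      ≡⟨ cong₂ (λ a b → qℕ 2 * a + qℕ 2 * b) (sum-qC*sq N) (sum-qC N) ⟩
    qℕ 2 * (qℕ N * qℕ 2 ^' N) + qℕ 2 * qℕ 2 ^' N
      ≡⟨ solve 2 (λ n p → con (qℕ 2) :* (n :* p) :+ con (qℕ 2) :* p := (con 1ℚ :+ n) :* (con (qℕ 2) :* p)) refl (qℕ N) (qℕ 2 ^' N) ⟩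
    (1ℚ + qℕ N) * (qℕ 2 * qℕ 2 ^' N)
      ≡⟨ cong (_* (qℕ 2 * qℕ 2 ^' N)) (sym (qℕ-suc N)) ⟩
    qℕ (suc N) * qℕ 2 ^' suc N ∎
  where
  open ≡-Reasoning
  summand : ∀ l → qC N l * sq (qℕ (suc N) - qℕ 2 * qℕ l) + qC N l * sq (qℕ (suc N) - qℕ 2 * qℕ (suc l)) ≡ qℕ 2 * (qC N l * sq (qℕ N - qℕ 2 * qℕ l)) + qℕ 2 * qC N l
  summand l = trans (cong₂ (λ a b → qC N l * sq (a - qℕ 2 * qℕ l) + qC N l * sq (a - qℕ 2 * b)) (qℕ-suc N) (qℕ-suc l)) (solve 3 (λ c n l → c :* ((con 1ℚ :+ n :- con (qℕ 2) :* l) :* (con 1ℚ :+ n :- con (qℕ 2) :* l)) :+ c :* ((con 1ℚ :+ n :- con (qℕ 2) :* (con 1ℚ :+ l)) :* (con 1ℚ :+ n :- con (qℕ 2) :* (con 1ℚ :+ l)))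
      := con (qℕ 2) :* (c :* ((n :- con (qℕ 2) :* l) :* (n :- con (qℕ 2) :* l))) :+ con (qℕ 2) :* c) refl (qC N l) (qℕ N) (qℕ l))

sum-qC*sq-half : ∀ n → sumTo ⌊ n /2⌋ (λ l → qC (suc n) l * sq (qℕ (suc n) - qℕ 2 * qℕ l)) ≡ qℕ (suc n) * qℕ 2 ^' n
sum-qC*sq-half n = *-cancelʳ _ _ (qℕ 2) (λ ()) (begin
    S * qℕ 2 ≡⟨ sym (sum-*ʳ ⌊ n /2⌋) ⟩
    sumTo ⌊ n /2⌋ (λ l → g l * qℕ 2) ≡⟨ sum-cong ⌊ n /2⌋ (λ l l≤ → cong (λ z → g l * weight z) (sym (e-dd l l≤))) ⟩
    sumTo ⌊ n /2⌋ (λ l → g l * weight (N ∸ 2 ℕ.* l)) ≡⟨ sym (sum-zero-tail′ ⌊ n /2⌋ ⌊ N /2⌋ (λ l → g l * weight (N ∸ 2 ℕ.* l)) (NP.⌊n/2⌋-mono (NP.n≤1+n n)) van) ⟩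
    sumTo ⌊ N /2⌋ (λ l → g l * weight (N ∸ 2 ℕ.* l)) ≡⟨ sym (sum-palindrome N g symg) ⟩
    sumTo N g ≡⟨ sum-qC*sq N ⟩
    qℕ N * qℕ 2 ^' N ≡⟨ solve 2 (λ a p → a :* (con (qℕ 2) :* p) := a :* p :* con (qℕ 2)) refl (qℕ N) (qℕ 2 ^' n) ⟩
    qℕ N * qℕ 2 ^' n * qℕ 2 ∎)
  where
  open ≡-Reasoning
  N = suc n
  g : ℕ → ℚ
  g l = qC N l * sq (qℕ N - qℕ 2 * qℕ l)
  S = sumTo ⌊ n /2⌋ g
  sum-*ʳ : ∀ M → sumTo M (λ l → g l * qℕ 2) ≡ sumTo M g * qℕ 2
  sum-*ʳ M = trans (sum-cong M (λ l _ → QP.*-comm (g l) (qℕ 2))) (trans (sum-*ˡ M (qℕ 2) g) (QP.*-comm (qℕ 2) (sumTo M g)))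
  e-dd : ∀ l → l ≤ ⌊ n /2⌋ → N ∸ 2 ℕ.* l ≡ suc (n ∸ 2 ℕ.* l)
  e-dd l l≤ = NP.+-∸-assoc 1 (NP.≤-trans (NP.≤-reflexive (2*≡+ l)) (≤⌊/2⌋⇒+≤ n l l≤))
  symg : ∀ l → l ≤ N → g l ≡ g (N ∸ l)
  symg l l≤N = cong₂ _*_ (cong qℕ (NC.nCk≡nC[n∸k] l≤N)) (begin
      sq (qℕ N - qℕ 2 * qℕ l) ≡⟨ solve 2 (λ a b → (a :- con (qℕ 2) :* b) :* (a :- con (qℕ 2) :* b) := (a :- con (qℕ 2) :* (a :- b)) :* (a :- con (qℕ 2) :* (a :- b))) refl (qℕ N) (qℕ l) ⟩
      sq (qℕ N - qℕ 2 * (qℕ N - qℕ l)) ≡⟨ cong (λ z → sq (qℕ N - qℕ 2 * z)) (sym (qℕ-∸ N l l≤N)) ⟩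
      sq (qℕ N - qℕ 2 * qℕ (N ∸ l)) ∎)
  van : ∀ l → ⌊ n /2⌋ < l → l ≤ ⌊ N /2⌋ → g l * weight (N ∸ 2 ℕ.* l) ≡ 0ℚ
  van l lt le = begin
      g l * weight (N ∸ 2 ℕ.* l) ≡⟨ cong (λ z → qC N l * sq (z - qℕ 2 * qℕ l) * weight (N ∸ 2 ℕ.* l)) (trans (cong qℕ (sym eq)) (qℕ-+ l l)) ⟩
      qC N l * sq ((qℕ l + qℕ l) - qℕ 2 * qℕ l) * weight (N ∸ 2 ℕ.* l) ≡⟨ solve 3 (λ c x d → c :* (((x :+ x) :- con (qℕ 2) :* x) :* ((x :+ x) :- con (qℕ 2) :* x)) :* d := con 0ℚ) refl (qC N l) (qℕ l) (weight (N ∸ 2 ℕ.* l)) ⟩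
      0ℚ ∎
    where
    a : l ℕ.+ l ≤ N
    a = ≤⌊/2⌋⇒+≤ N l le
    b : N ≤ l ℕ.+ l
    b = NP.≰⇒> (λ le' → NP.<⇒≱ lt (+≤⇒≤⌊/2⌋ n l le'))
    eq : l ℕ.+ l ≡ N
    eq = NP.≤-antisym a b

hockey-stick : ∀ n a → sumTo n (λ m → qC m a) ≡ qC (suc n) (suc a)
hockey-stick zero zero = refl
hockey-stick zero (suc a) = refl
hockey-stick (suc n) a = trans (cong (_+ qC (suc n) a) (hockey-stick n a)) (trans (QP.+-comm (qC (suc n) (suc a)) (qC (suc n) a)) (sym (qC-pascal (suc n) a)))

vandermonde : ∀ n a b → sumTo n (λ m → qC m a * qC (n ∸ m) b) ≡ qC (suc n) (suc (a ℕ.+ b))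
vandermonde zero zero zero = refl
vandermonde zero zero (suc b) = refl
vandermonde zero (suc a) b = QP.*-zeroˡ (qC 0 b)
vandermonde (suc n) a zero = trans (sum-cong (suc n) (λ m _ → QP.*-identityʳ (qC m a))) (trans (hockey-stick (suc n) a) (cong (λ z → qC (suc (suc n)) (suc z)) (sym (NP.+-identityʳ a))))
vandermonde (suc n) a (suc b) = begin
    sumTo n (λ m → qC m a * qC (suc n ∸ m) (suc b)) + qC (suc n) a * qC (n ∸ n) (suc b)
      ≡⟨ cong₂ _+_ (sum-cong n (λ m m≤n → trans (cong (λ z → qC m a * qC z (suc b)) (NP.+-∸-assoc 1 m≤n)) (trans (cong (qC m a *_) (qC-pascal (n ∸ m) b)) (QP.*-distribˡ-+ (qC m a) (qC (n ∸ m) b) (qC (n ∸ m) (suc b)))))) (cong (λ z → qC (suc n) a * qC z (suc b)) (NP.n∸n≡0 n)) ⟩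
    sumTo n (λ m → qC m a * qC (n ∸ m) b + qC m a * qC (n ∸ m) (suc b)) + qC (suc n) a * 0ℚ
      ≡⟨ +*0 (sumTo n (λ m → qC m a * qC (n ∸ m) b + qC m a * qC (n ∸ m) (suc b))) (qC (suc n) a) ⟩
    sumTo n (λ m → qC m a * qC (n ∸ m) b + qC m a * qC (n ∸ m) (suc b))
      ≡⟨ sum-+ n _ _ ⟩
    sumTo n (λ m → qC m a * qC (n ∸ m) b) + sumTo n (λ m → qC m a * qC (n ∸ m) (suc b))
      ≡⟨ cong₂ _+_ (vandermonde n a b) (vandermonde n a (suc b)) ⟩
    qC (suc n) (suc (a ℕ.+ b)) + qC (suc n) (suc (a ℕ.+ suc b))
      ≡⟨ cong (λ z → qC (suc n) (suc (a ℕ.+ b)) + qC (suc n) (suc z)) (NP.+-suc a b) ⟩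
    qC (suc n) (suc (a ℕ.+ b)) + qC (suc n) (suc (suc (a ℕ.+ b)))
      ≡⟨ sym (qC-pascal (suc n) (suc (a ℕ.+ b))) ⟩
    qC (suc (suc n)) (suc (suc (a ℕ.+ b)))
      ≡⟨ cong (λ z → qC (suc (suc n)) (suc z)) (sym (NP.+-suc a b)) ⟩
    qC (suc (suc n)) (suc (a ℕ.+ suc b)) ∎
  where open ≡-Reasoning


-- Chu–Vandermonde and Pfaff

chuSum : ℕ → ℚ → ℚ → ℚ
chuSum s b c = sumTo s (λ k → qC s k * (sign k * poch b k * poch (c + qℕ k) (s ∸ k)))

chuSum≡poch : ∀ s b c → chuSum s b c ≡ poch (c - b) s
chuSum≡poch zero b c = refl
chuSum≡poch (suc s) b c = begin
    chuSum (suc s) b c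
      ≡⟨ pascal-sum s F ⟩
    sumTo s (λ k → qC s k * F k) + sumTo s (λ k → qC s k * F (suc k))
      ≡⟨ cong₂ _+_ (trans (sum-cong s (λ k k≤s → term-k k k≤s)) (sum-*ˡ s (c + qℕ s) (λ k → qC s k * G b c k)))
                   (trans (sum-cong s (λ k _ → term-suc-k k)) (sum-*ˡ s (- b) (λ k → qC s k * G (b + 1ℚ) (c + 1ℚ) k))) ⟩
    (c + qℕ s) * chuSum s b c + (- b) * chuSum s (b + 1ℚ) (c + 1ℚ)
      ≡⟨ cong₂ (λ x y → (c + qℕ s) * x + (- b) * y) (chuSum≡poch s b c) (trans (chuSum≡poch s (b + 1ℚ) (c + 1ℚ)) (cong (λ z → poch z s) e1)) ⟩
    (c + qℕ s) * poch (c - b) s + (- b) * poch (c - b) s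
      ≡⟨ solve 4 (λ c s b p → (c :+ s) :* p :+ (:- b) :* p := p :* ((c :- b) :+ s)) refl c (qℕ s) b (poch (c - b) s) ⟩
    poch (c - b) (suc s) ∎
  where
  open ≡-Reasoning
  G : ℚ → ℚ → ℕ → ℚ
  G b c k = sign k * poch b k * poch (c + qℕ k) (s ∸ k)
  F : ℕ → ℚ
  F k = sign k * poch b k * poch (c + qℕ k) (suc s ∸ k)
  e1 : (c + 1ℚ) - (b + 1ℚ) ≡ c - b
  e1 = solve 2 (λ c b → (c :+ con 1ℚ) :- (b :+ con 1ℚ) := c :- b) refl c b
  term-k : ∀ k → k ≤ s → qC s k * F k ≡ (c + qℕ s) * (qC s k * G b c k)
  term-k k k≤s = begin
      qC s k * (sign k * poch b k * poch (c + qℕ k) (suc s ∸ k))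
        ≡⟨ cong (λ z → qC s k * (sign k * poch b k * poch (c + qℕ k) z)) (NP.+-∸-assoc 1 k≤s) ⟩
      qC s k * (sign k * poch b k * (poch (c + qℕ k) (s ∸ k) * ((c + qℕ k) + qℕ (s ∸ k))))
        ≡⟨ cong (λ z → qC s k * (sign k * poch b k * (poch (c + qℕ k) (s ∸ k) * z))) e2 ⟩
      qC s k * (sign k * poch b k * (poch (c + qℕ k) (s ∸ k) * (c + qℕ s)))
        ≡⟨ solve 5 (λ q g p r x → q :* (g :* p :* (r :* x)) := x :* (q :* (g :* p :* r))) refl (qC s k) (sign k) (poch b k) (poch (c + qℕ k) (s ∸ k)) (c + qℕ s) ⟩
      (c + qℕ s) * (qC s k * G b c k) ∎
    where
    e2 : (c + qℕ k) + qℕ (s ∸ k) ≡ c + qℕ s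
    e2 = trans (QP.+-assoc c (qℕ k) (qℕ (s ∸ k))) (cong (c +_) (trans (sym (qℕ-+ k (s ∸ k))) (cong qℕ (NP.m+[n∸m]≡n k≤s))))
  term-suc-k : ∀ k → qC s k * F (suc k) ≡ (- b) * (qC s k * G (b + 1ℚ) (c + 1ℚ) k)
  term-suc-k k = begin
      qC s k * (sign (suc k) * poch b (suc k) * poch (c + qℕ (suc k)) (s ∸ k))
        ≡⟨ cong₂ (λ x y → qC s k * (sign (suc k) * x * poch y (s ∸ k))) (poch-suc-shift b k) e3 ⟩
      qC s k * (sign (suc k) * (b * poch (b + 1ℚ) k) * poch ((c + 1ℚ) + qℕ k) (s ∸ k))
        ≡⟨ solve 5 (λ q g b p r → q :* ((:- con 1ℚ :* g) :* (b :* p) :* r) := (:- b) :* (q :* (g :* p :* r))) refl (qC s k) (sign k) b (poch (b + 1ℚ) k) (poch ((c + 1ℚ) + qℕ k) (s ∸ k)) ⟩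
      (- b) * (qC s k * G (b + 1ℚ) (c + 1ℚ) k) ∎
    where
    e3 : c + qℕ (suc k) ≡ (c + 1ℚ) + qℕ k
    e3 = trans (cong (c +_) (qℕ-suc k)) (sym (QP.+-assoc c 1ℚ (qℕ k)))

chu-vandermonde : ∀ s b c → poch c s ≢ 0ℚ → sumTo s (λ k → qC s k * (sign k * poch b k * inv (poch c k))) ≡ poch (c - b) s * inv (poch c s)
chu-vandermonde s b c nz = begin
    Σ ≡⟨ sym (QP.*-identityˡ Σ) ⟩
    1ℚ * Σ ≡⟨ cong (_* Σ) (sym (trans (QP.*-comm (inv (poch c s)) (poch c s)) (*-inv (poch c s) nz))) ⟩
    (inv (poch c s) * poch c s) * Σ ≡⟨ QP.*-assoc (inv (poch c s)) (poch c s) Σ ⟩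
    inv (poch c s) * (poch c s * Σ) ≡⟨ cong (inv (poch c s) *_) (sym (sum-*ˡ s (poch c s) _)) ⟩
    inv (poch c s) * sumTo s (λ k → poch c s * (qC s k * (sign k * poch b k * inv (poch c k)))) ≡⟨ cong (inv (poch c s) *_) (sum-cong s summand) ⟩
    inv (poch c s) * chuSum s b c ≡⟨ cong (inv (poch c s) *_) (chuSum≡poch s b c) ⟩
    inv (poch c s) * poch (c - b) s ≡⟨ QP.*-comm (inv (poch c s)) (poch (c - b) s) ⟩
    poch (c - b) s * inv (poch c s) ∎
  where
  open ≡-Reasoning
  Σ = sumTo s (λ k → qC s k * (sign k * poch b k * inv (poch c k)))
  summand : ∀ k → k ≤ s → poch c s * (qC s k * (sign k * poch b k * inv (poch c k))) ≡ qC s k * (sign k * poch b k * poch (c + qℕ k) (s ∸ k))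
  summand k k≤s = begin
      poch c s * (qC s k * (sign k * poch b k * inv (poch c k)))
        ≡⟨ solve 5 (λ P q g p i → P :* (q :* (g :* p :* i)) := q :* (g :* p :* (P :* i))) refl (poch c s) (qC s k) (sign k) (poch b k) (inv (poch c k)) ⟩
      qC s k * (sign k * poch b k * (poch c s * inv (poch c k)))
        ≡⟨ cong (λ z → qC s k * (sign k * poch b k * z)) (sym (inv-solve (poch c s) (poch c k) (poch (c + qℕ k) (s ∸ k)) (poch-split c k s k≤s) nz)) ⟩
      qC s k * (sign k * poch b k * poch (c + qℕ k) (s ∸ k)) ∎

poch-neg*qC-core : ∀ k t u → poch (- qℕ (k ℕ.+ (t ℕ.+ u))) k * inv (fact k) * qC (t ℕ.+ u) t ≡ sign k * qC (k ℕ.+ (t ℕ.+ u)) (k ℕ.+ t) * qC (k ℕ.+ t) k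
poch-neg*qC-core k t u = *-cancelʳ _ _ X X≢0 (trans l (sym r))
  where
  open ≡-Reasoning
  X = fact k * fact t * fact u
  X≢0 : X ≢ 0ℚ
  X≢0 = *≢0 _ _ (*≢0 _ _ (fact≢0 k) (fact≢0 t)) (fact≢0 u)
  P = poch (- qℕ (k ℕ.+ (t ℕ.+ u))) k
  l : P * inv (fact k) * qC (t ℕ.+ u) t * X ≡ sign k * fact (k ℕ.+ (t ℕ.+ u))
  l = begin
      P * inv (fact k) * qC (t ℕ.+ u) t * X
        ≡⟨ solve 6 (λ P i q a b c → P :* i :* q :* (a :* b :* c) := (a :* i) :* (P :* (q :* (b :* c)))) refl P (inv (fact k)) (qC (t ℕ.+ u) t) (fact k) (fact t) (fact u) ⟩
      (fact k * inv (fact k)) * (P * (qC (t ℕ.+ u) t * (fact t * fact u)))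
        ≡⟨ cong₂ (λ x y → x * (P * y)) (*-inv (fact k) (fact≢0 k)) (qC*fact*fact t u) ⟩
      1ℚ * (P * fact (t ℕ.+ u))
        ≡⟨ QP.*-identityˡ _ ⟩
      P * fact (t ℕ.+ u)
        ≡⟨ poch-neg*fact k (t ℕ.+ u) ⟩
      sign k * fact (k ℕ.+ (t ℕ.+ u)) ∎
  r : sign k * qC (k ℕ.+ (t ℕ.+ u)) (k ℕ.+ t) * qC (k ℕ.+ t) k * X ≡ sign k * fact (k ℕ.+ (t ℕ.+ u))
  r = begin
      sign k * qC (k ℕ.+ (t ℕ.+ u)) (k ℕ.+ t) * qC (k ℕ.+ t) k * X
        ≡⟨ solve 6 (λ g Q q a b c → g :* Q :* q :* (a :* b :* c) := g :* (Q :* ((q :* (a :* b)) :* c))) refl (sign k) (qC (k ℕ.+ (t ℕ.+ u)) (k ℕ.+ t)) (qC (k ℕ.+ t) k) (fact k) (fact t) (fact u) ⟩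
      sign k * (qC (k ℕ.+ (t ℕ.+ u)) (k ℕ.+ t) * ((qC (k ℕ.+ t) k * (fact k * fact t)) * fact u))
        ≡⟨ cong (λ z → sign k * (qC (k ℕ.+ (t ℕ.+ u)) (k ℕ.+ t) * (z * fact u))) (qC*fact*fact k t) ⟩
      sign k * (qC (k ℕ.+ (t ℕ.+ u)) (k ℕ.+ t) * (fact (k ℕ.+ t) * fact u))
        ≡⟨ cong (λ z → sign k * (qC z (k ℕ.+ t) * (fact (k ℕ.+ t) * fact u))) (sym (NP.+-assoc k t u)) ⟩
      sign k * (qC ((k ℕ.+ t) ℕ.+ u) (k ℕ.+ t) * (fact (k ℕ.+ t) * fact u))
        ≡⟨ cong (sign k *_) (qC*fact*fact (k ℕ.+ t) u) ⟩
      sign k * fact ((k ℕ.+ t) ℕ.+ u)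
        ≡⟨ cong (λ z → sign k * fact z) (NP.+-assoc k t u) ⟩
      sign k * fact (k ℕ.+ (t ℕ.+ u)) ∎

poch-neg*qC-split : ∀ m s k t u → s ≡ k ℕ.+ t → m ≡ s ℕ.+ u → poch (- qℕ m) k * inv (fact k) * qC (m ∸ k) (s ∸ k) ≡ sign k * qC m s * qC s k
poch-neg*qC-split .((k ℕ.+ t) ℕ.+ u) .(k ℕ.+ t) k t u refl refl = begin
    poch (- qℕ ((k ℕ.+ t) ℕ.+ u)) k * inv (fact k) * qC ((k ℕ.+ t) ℕ.+ u ∸ k) (k ℕ.+ t ∸ k)
      ≡⟨ cong₂ (λ a b → poch (- qℕ a) k * inv (fact k) * qC (a ∸ k) b) (NP.+-assoc k t u) (NP.m+n∸m≡n k t) ⟩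
    poch (- qℕ (k ℕ.+ (t ℕ.+ u))) k * inv (fact k) * qC (k ℕ.+ (t ℕ.+ u) ∸ k) t
      ≡⟨ cong (λ a → poch (- qℕ (k ℕ.+ (t ℕ.+ u))) k * inv (fact k) * qC a t) (NP.m+n∸m≡n k (t ℕ.+ u)) ⟩
    poch (- qℕ (k ℕ.+ (t ℕ.+ u))) k * inv (fact k) * qC (t ℕ.+ u) t
      ≡⟨ poch-neg*qC-core k t u ⟩
    sign k * qC (k ℕ.+ (t ℕ.+ u)) (k ℕ.+ t) * qC (k ℕ.+ t) k
      ≡⟨ cong (λ a → sign k * qC a (k ℕ.+ t) * qC (k ℕ.+ t) k) (sym (NP.+-assoc k t u)) ⟩
    sign k * qC ((k ℕ.+ t) ℕ.+ u) (k ℕ.+ t) * qC (k ℕ.+ t) k ∎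
  where open ≡-Reasoning

poch-neg*qC : ∀ m s k → k ≤ s → s ≤ m → poch (- qℕ m) k * inv (fact k) * qC (m ∸ k) (s ∸ k) ≡ sign k * qC m s * qC s k
poch-neg*qC m s k k≤s s≤m = poch-neg*qC-split m s k (s ∸ k) (m ∸ s) (sym (NP.m+[n∸m]≡n k≤s)) (sym (NP.m+[n∸m]≡n s≤m))

pfaffCoeff : ℕ → ℚ → ℚ → ℕ → ℚ
pfaffCoeff m b c k = poch (- qℕ m) k * poch b k * inv (poch c k * fact k)

poch-neg*inv-fact : ∀ m s → s ≤ m → poch (- qℕ m) s * inv (fact s) ≡ sign s * qC m s
poch-neg*inv-fact m s s≤m = begin
    poch (- qℕ m) s * inv (fact s) ≡⟨ sym (QP.*-identityʳ _) ⟩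
    poch (- qℕ m) s * inv (fact s) * qC (m ∸ s) 0 ≡⟨ cong (λ z → poch (- qℕ m) s * inv (fact s) * qC (m ∸ s) z) (sym (NP.n∸n≡0 s)) ⟩
    poch (- qℕ m) s * inv (fact s) * qC (m ∸ s) (s ∸ s) ≡⟨ poch-neg*qC m s s NP.≤-refl s≤m ⟩
    sign s * qC m s * qC s s ≡⟨ cong (λ z → sign s * qC m s * qℕ z) (NC.nCn≡1 s) ⟩
    sign s * qC m s * 1ℚ ≡⟨ QP.*-identityʳ _ ⟩
    sign s * qC m s ∎
  where open ≡-Reasoning

pfaff-lhs-summand : ∀ m b c k → k ≤ m →
  qℕ 5 ^' m * ((poch (- qℕ m) k * poch b k * ⅘ ^' k) ÷' (poch c k * fact k))
  ≡ pfaffCoeff m b c k * qℕ 4 ^' k * qℕ 5 ^' (m ∸ k)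
pfaff-lhs-summand m b c k k≤m = begin
    qℕ 5 ^' m * ((poch (- qℕ m) k * poch b k * ⅘ ^' k) ÷' (poch c k * fact k))
      ≡⟨ cong₂ _*_ (trans (cong (qℕ 5 ^'_) (sym (NP.m+[n∸m]≡n k≤m))) (^'-+ (qℕ 5) k (m ∸ k))) (÷'≡*inv (poch (- qℕ m) k * poch b k * ⅘ ^' k) (poch c k * fact k)) ⟩
    (qℕ 5 ^' k * qℕ 5 ^' (m ∸ k)) * ((poch (- qℕ m) k * poch b k * ⅘ ^' k) * inv (poch c k * fact k))
      ≡⟨ solve 6 (λ F G P B Q I → (F :* G) :* ((P :* B :* Q) :* I) := (P :* B :* I) :* (Q :* F) :* G) refl (qℕ 5 ^' k) (qℕ 5 ^' (m ∸ k)) (poch (- qℕ m) k) (poch b k) (⅘ ^' k) (inv (poch c k * fact k)) ⟩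
    pfaffCoeff m b c k * (⅘ ^' k * qℕ 5 ^' k) * qℕ 5 ^' (m ∸ k)
      ≡⟨ cong (λ z → pfaffCoeff m b c k * z * qℕ 5 ^' (m ∸ k)) (sym (^'-* ⅘ (qℕ 5) k)) ⟩
    pfaffCoeff m b c k * (⅘ * qℕ 5) ^' k * qℕ 5 ^' (m ∸ k) ∎
  where open ≡-Reasoning

pfaff-rhs-summand : ∀ m b c s → s ≤ m →
  (poch (- qℕ m) s * poch (c - b) s * (- qℕ 4) ^' s) ÷' (poch c s * fact s)
  ≡ qℕ 4 ^' s * qC m s * (poch (c - b) s * inv (poch c s))
pfaff-rhs-summand m b c s s≤m = begin
    (poch (- qℕ m) s * poch (c - b) s * (- qℕ 4) ^' s) ÷' (poch c s * fact s)
      ≡⟨ trans (÷'≡*inv (poch (- qℕ m) s * poch (c - b) s * (- qℕ 4) ^' s) (poch c s * fact s)) (cong₂ (λ x y → poch (- qℕ m) s * poch (c - b) s * x * y) (neg4^' s) (inv-distrib-* (poch c s) (fact s))) ⟩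
    poch (- qℕ m) s * poch (c - b) s * (sign s * qℕ 4 ^' s) * (inv (poch c s) * inv (fact s))
      ≡⟨ solve 6 (λ P R g F I J → P :* R :* (g :* F) :* (I :* J) := (P :* J) :* g :* (F :* (R :* I))) refl (poch (- qℕ m) s) (poch (c - b) s) (sign s) (qℕ 4 ^' s) (inv (poch c s)) (inv (fact s)) ⟩
    (poch (- qℕ m) s * inv (fact s)) * sign s * (qℕ 4 ^' s * (poch (c - b) s * inv (poch c s)))
      ≡⟨ cong (λ z → z * sign s * (qℕ 4 ^' s * (poch (c - b) s * inv (poch c s)))) (poch-neg*inv-fact m s s≤m) ⟩
    sign s * qC m s * sign s * (qℕ 4 ^' s * (poch (c - b) s * inv (poch c s)))
      ≡⟨ solve 4 (λ g M F X → g :* M :* g :* (F :* X) := (g :* g) :* (F :* M :* X)) refl (sign s) (qC m s) (qℕ 4 ^' s) (poch (c - b) s * inv (poch c s)) ⟩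
    (sign s * sign s) * (qℕ 4 ^' s * qC m s * (poch (c - b) s * inv (poch c s)))
      ≡⟨ trans (cong (_* (qℕ 4 ^' s * qC m s * (poch (c - b) s * inv (poch c s)))) (sign-*-sign s)) (QP.*-identityˡ _) ⟩
    qℕ 4 ^' s * qC m s * (poch (c - b) s * inv (poch c s)) ∎
  where open ≡-Reasoning

pfaff-antidiagonal : ∀ m b c s → s ≤ m → poch c s ≢ 0ℚ →
  sumTo s (λ k → pfaffCoeff m b c k * qC (m ∸ k) (s ∸ k) * qℕ 4 ^' s)
  ≡ qℕ 4 ^' s * qC m s * (poch (c - b) s * inv (poch c s))
pfaff-antidiagonal m b c s s≤m nz = begin
    sumTo s (λ k → pfaffCoeff m b c k * qC (m ∸ k) (s ∸ k) * qℕ 4 ^' s)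
      ≡⟨ sum-cong s summand ⟩
    sumTo s (λ k → (qℕ 4 ^' s * qC m s) * (qC s k * (sign k * poch b k * inv (poch c k))))
      ≡⟨ sum-*ˡ s (qℕ 4 ^' s * qC m s) _ ⟩
    (qℕ 4 ^' s * qC m s) * sumTo s (λ k → qC s k * (sign k * poch b k * inv (poch c k)))
      ≡⟨ cong ((qℕ 4 ^' s * qC m s) *_) (chu-vandermonde s b c nz) ⟩
    qℕ 4 ^' s * qC m s * (poch (c - b) s * inv (poch c s)) ∎
  where
  open ≡-Reasoning
  summand : ∀ k → k ≤ s → pfaffCoeff m b c k * qC (m ∸ k) (s ∸ k) * qℕ 4 ^' s ≡ (qℕ 4 ^' s * qC m s) * (qC s k * (sign k * poch b k * inv (poch c k)))
  summand k k≤s = begin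
      poch (- qℕ m) k * poch b k * inv (poch c k * fact k) * qC (m ∸ k) (s ∸ k) * qℕ 4 ^' s
        ≡⟨ cong (λ z → poch (- qℕ m) k * poch b k * z * qC (m ∸ k) (s ∸ k) * qℕ 4 ^' s) (inv-distrib-* (poch c k) (fact k)) ⟩
      poch (- qℕ m) k * poch b k * (inv (poch c k) * inv (fact k)) * qC (m ∸ k) (s ∸ k) * qℕ 4 ^' s
        ≡⟨ solve 6 (λ P B I J Q F → P :* B :* (I :* J) :* Q :* F := (P :* J :* Q) :* (B :* I :* F)) refl (poch (- qℕ m) k) (poch b k) (inv (poch c k)) (inv (fact k)) (qC (m ∸ k) (s ∸ k)) (qℕ 4 ^' s) ⟩
      (poch (- qℕ m) k * inv (fact k) * qC (m ∸ k) (s ∸ k)) * (poch b k * inv (poch c k) * qℕ 4 ^' s)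
        ≡⟨ cong (_* (poch b k * inv (poch c k) * qℕ 4 ^' s)) (poch-neg*qC m s k k≤s s≤m) ⟩
      (sign k * qC m s * qC s k) * (poch b k * inv (poch c k) * qℕ 4 ^' s)
        ≡⟨ solve 6 (λ g M S B I F → (g :* M :* S) :* (B :* I :* F) := (F :* M) :* (S :* (g :* B :* I))) refl (sign k) (qC m s) (qC s k) (poch b k) (inv (poch c k)) (qℕ 4 ^' s) ⟩
      (qℕ 4 ^' s * qC m s) * (qC s k * (sign k * poch b k * inv (poch c k))) ∎

-- Expand 5^(m-k) = (1+4)^(m-k) and regroup by the total power of 4.
pfaff : ∀ m b c → poch c m ≢ 0ℚ →
   qℕ 5 ^' m * sumTo m (λ k → (poch (- qℕ m) k * poch b k * ⅘ ^' k) ÷' (poch c k * fact k))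
   ≡ sumTo m (λ s → (poch (- qℕ m) s * poch (c - b) s * (- qℕ 4) ^' s) ÷' (poch c s * fact s))
pfaff m b c nz = begin
    qℕ 5 ^' m * sumTo m T
      ≡⟨ sym (sum-*ˡ m (qℕ 5 ^' m) T) ⟩
    sumTo m (λ k → qℕ 5 ^' m * T k)
      ≡⟨ sum-cong m (pfaff-lhs-summand m b c) ⟩
    sumTo m (λ k → pfaffCoeff m b c k * qℕ 4 ^' k * qℕ 5 ^' (m ∸ k))
      ≡⟨ sum-cong m (λ k _ → cong (λ z → pfaffCoeff m b c k * qℕ 4 ^' k * z) (sym (binomial-theorem (m ∸ k) (qℕ 4)))) ⟩
    sumTo m (λ k → pfaffCoeff m b c k * qℕ 4 ^' k * sumTo (m ∸ k) (λ t → qC (m ∸ k) t * qℕ 4 ^' t))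
      ≡⟨ sum-cong m (λ k _ → sym (sum-*ˡ (m ∸ k) (pfaffCoeff m b c k * qℕ 4 ^' k) (λ t → qC (m ∸ k) t * qℕ 4 ^' t))) ⟩
    sumTo m (λ k → sumTo (m ∸ k) (λ t → pfaffCoeff m b c k * qℕ 4 ^' k * (qC (m ∸ k) t * qℕ 4 ^' t)))
      ≡⟨ sum-cong m (λ k _ → sum-cong (m ∸ k) (λ t _ → regroup k t)) ⟩
    sumTo m (λ k → sumTo (m ∸ k) (λ t → f (k ℕ.+ t) k))
      ≡⟨ sym (sum-triangle m f) ⟩
    sumTo m (λ s → sumTo s (λ k → f s k))
      ≡⟨ sum-cong m (λ s s≤m → pfaff-antidiagonal m b c s s≤m (poch-prefix≢0 c s m s≤m nz)) ⟩
    sumTo m (λ s → qℕ 4 ^' s * qC m s * (poch (c - b) s * inv (poch c s)))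
      ≡⟨ sum-cong m (λ s s≤m → sym (pfaff-rhs-summand m b c s s≤m)) ⟩
    sumTo m (λ s → (poch (- qℕ m) s * poch (c - b) s * (- qℕ 4) ^' s) ÷' (poch c s * fact s)) ∎
  where
  open ≡-Reasoning
  T : ℕ → ℚ
  T k = (poch (- qℕ m) k * poch b k * ⅘ ^' k) ÷' (poch c k * fact k)
  f : ℕ → ℕ → ℚ
  f s k = pfaffCoeff m b c k * qC (m ∸ k) (s ∸ k) * qℕ 4 ^' s
  regroup : ∀ k t → pfaffCoeff m b c k * qℕ 4 ^' k * (qC (m ∸ k) t * qℕ 4 ^' t) ≡ f (k ℕ.+ t) k
  regroup k t = begin
      pfaffCoeff m b c k * qℕ 4 ^' k * (qC (m ∸ k) t * qℕ 4 ^' t)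
        ≡⟨ solve 4 (λ a x q y → a :* x :* (q :* y) := a :* q :* (x :* y)) refl (pfaffCoeff m b c k) (qℕ 4 ^' k) (qC (m ∸ k) t) (qℕ 4 ^' t) ⟩
      pfaffCoeff m b c k * qC (m ∸ k) t * (qℕ 4 ^' k * qℕ 4 ^' t)
        ≡⟨ cong₂ (λ x y → pfaffCoeff m b c k * qC (m ∸ k) x * y) (sym (NP.m+n∸m≡n k t)) (sym (^'-+ (qℕ 4) k t)) ⟩
      f (k ℕ.+ t) k ∎

-- Fibonacci numbers

-- fib j is the Fibonacci number F(j+1).
fib : ℕ → ℚ
fib j = sumTo j (λ k → qC (j ∸ k) k)

fib-rec : ∀ j → fib (suc (suc j)) ≡ fib (suc j) + fib j
fib-rec j = begin
    fib (suc (suc j)) ≡⟨ sum-shift (suc j) (λ k → qC (suc (suc j) ∸ k) k) ⟩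
    1ℚ + X ≡⟨ cong (λ z → 1ℚ + z) eX ⟩
    1ℚ + (fib j + Y) ≡⟨ solve 3 (λ d y o → o :+ (d :+ y) := (o :+ y) :+ d) refl (fib j) Y 1ℚ ⟩
    (1ℚ + Y) + fib j ≡⟨ cong (_+ fib j) (sym (sum-shift j (λ k → qC (suc j ∸ k) k))) ⟩
    fib (suc j) + fib j ∎
  where
  open ≡-Reasoning
  X = sumTo (suc j) (λ k → qC (suc j ∸ k) (suc k))
  Y = sumTo j (λ k → qC (j ∸ k) (suc k))
  eX : X ≡ fib j + Y
  eX = begin
     sumTo j (λ k → qC (suc j ∸ k) (suc k)) + qC (j ∸ j) (suc (suc j))
       ≡⟨ cong₂ _+_ (sum-cong j (λ k k≤j → trans (cong (λ z → qC z (suc k)) (NP.+-∸-assoc 1 k≤j)) (qC-pascal (j ∸ k) k))) (cong (λ z → qC z (suc (suc j))) (NP.n∸n≡0 j)) ⟩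
     sumTo j (λ k → qC (j ∸ k) k + qC (j ∸ k) (suc k)) + 0ℚ
       ≡⟨ QP.+-identityʳ _ ⟩
     sumTo j (λ k → qC (j ∸ k) k + qC (j ∸ k) (suc k))
       ≡⟨ sum-+ j _ _ ⟩
     fib j + Y ∎

oddSum5 : ℕ → ℚ
oddSum5 n = sumTo n (λ k → qℕ 5 ^' k * qC n (suc (k ℕ.+ k)))

evenSum5 : ℕ → ℚ
evenSum5 n = sumTo n (λ k → qℕ 5 ^' k * qC n (k ℕ.+ k))

qC[n,2n+2]≡0 : ∀ n → qC n (suc n ℕ.+ suc n) ≡ 0ℚ
qC[n,2n+2]≡0 n = qC-> n _ (s≤s (NP.m≤m+n n (suc n)))

qC[n,2n+3]≡0 : ∀ n → qC n (suc (suc n ℕ.+ suc n)) ≡ 0ℚ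
qC[n,2n+3]≡0 n = qC-> n _ (s≤s (NP.m≤n⇒m≤1+n (NP.m≤m+n n (suc n))))

oddSum5-suc : ∀ n → oddSum5 (suc n) ≡ oddSum5 n + evenSum5 n
oddSum5-suc n = begin
    oddSum5 (suc n)
      ≡⟨ sum-cong (suc n) (λ k _ → trans (cong (qℕ 5 ^' k *_) (qC-pascal n (k ℕ.+ k))) (QP.*-distribˡ-+ (qℕ 5 ^' k) _ _)) ⟩
    sumTo (suc n) (λ k → qℕ 5 ^' k * qC n (k ℕ.+ k) + qℕ 5 ^' k * qC n (suc (k ℕ.+ k)))
      ≡⟨ sum-+ (suc n) _ _ ⟩
    sumTo (suc n) (λ k → qℕ 5 ^' k * qC n (k ℕ.+ k)) + sumTo (suc n) (λ k → qℕ 5 ^' k * qC n (suc (k ℕ.+ k)))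
      ≡⟨ cong₂ _+_ (trans (cong (λ z → evenSum5 n + qℕ 5 ^' suc n * z) (qC[n,2n+2]≡0 n)) (+*0 (evenSum5 n) (qℕ 5 ^' suc n)))
                   (trans (cong (λ z → oddSum5 n + qℕ 5 ^' suc n * z) (qC[n,2n+3]≡0 n)) (+*0 (oddSum5 n) (qℕ 5 ^' suc n))) ⟩
    evenSum5 n + oddSum5 n ≡⟨ QP.+-comm (evenSum5 n) (oddSum5 n) ⟩
    oddSum5 n + evenSum5 n ∎
  where open ≡-Reasoning

evenSum5-suc : ∀ n → evenSum5 (suc n) ≡ evenSum5 n + qℕ 5 * oddSum5 n
evenSum5-suc n = begin
    evenSum5 (suc n)
      ≡⟨ sum-shift n (λ k → qℕ 5 ^' k * qC (suc n) (k ℕ.+ k)) ⟩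
    1ℚ * 1ℚ + sumTo n (λ k → qℕ 5 ^' suc k * qC (suc n) (suc k ℕ.+ suc k))
      ≡⟨ cong (λ z → 1ℚ * 1ℚ + z) (sum-cong n (λ k _ → summand k)) ⟩
    1ℚ * 1ℚ + sumTo n (λ k → qℕ 5 * (qℕ 5 ^' k * qC n (suc (k ℕ.+ k))) + qℕ 5 ^' suc k * qC n (suc k ℕ.+ suc k))
      ≡⟨ cong (λ z → 1ℚ * 1ℚ + z) (trans (sum-+ n _ _) (cong (_+ Z) (sum-*ˡ n (qℕ 5) _))) ⟩
    1ℚ * 1ℚ + (qℕ 5 * oddSum5 n + Z)
      ≡⟨ solve 3 (λ o p z → o :+ (p :+ z) := (o :+ z) :+ p) refl (1ℚ * 1ℚ) (qℕ 5 * oddSum5 n) Z ⟩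
    (1ℚ * 1ℚ + Z) + qℕ 5 * oddSum5 n
      ≡⟨ cong (_+ qℕ 5 * oddSum5 n) (sym eE) ⟩
    evenSum5 n + qℕ 5 * oddSum5 n ∎
  where
  open ≡-Reasoning
  Z = sumTo n (λ k → qℕ 5 ^' suc k * qC n (suc k ℕ.+ suc k))
  summand : ∀ k → qℕ 5 ^' suc k * qC (suc n) (suc k ℕ.+ suc k) ≡ qℕ 5 * (qℕ 5 ^' k * qC n (suc (k ℕ.+ k))) + qℕ 5 ^' suc k * qC n (suc k ℕ.+ suc k)
  summand k = trans (cong (qℕ 5 ^' suc k *_) (trans (qC-pascal n (k ℕ.+ suc k)) (cong (λ z → qC n z + qC n (suc (k ℕ.+ suc k))) (NP.+-suc k k)))) (solve 4 (λ f p a b → (f :* p) :* (a :+ b) := f :* (p :* a) :+ (f :* p) :* b) refl (qℕ 5) (qℕ 5 ^' k) (qC n (suc (k ℕ.+ k))) (qC n (suc k ℕ.+ suc k)))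
  eE : evenSum5 n ≡ 1ℚ * 1ℚ + Z
  eE = begin
     evenSum5 n ≡⟨ sym (QP.+-identityʳ (evenSum5 n)) ⟩
     evenSum5 n + 0ℚ ≡⟨ cong (evenSum5 n +_) (sym (trans (cong (qℕ 5 ^' suc n *_) (qC[n,2n+2]≡0 n)) (QP.*-zeroʳ (qℕ 5 ^' suc n)))) ⟩
     sumTo (suc n) (λ k → qℕ 5 ^' k * qC n (k ℕ.+ k)) ≡⟨ sum-shift n (λ k → qℕ 5 ^' k * qC n (k ℕ.+ k)) ⟩
     1ℚ * 1ℚ + Z ∎

oddSum5≡2^'*fib : ∀ j → oddSum5 (suc j) ≡ qℕ 2 ^' j * fib j
oddSum5≡2^'*fib zero = refl
oddSum5≡2^'*fib (suc zero) = refl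
oddSum5≡2^'*fib (suc (suc j)) = begin
    oddSum5 (suc (suc (suc j)))
      ≡⟨ oddSum5-suc (suc (suc j)) ⟩
    oddSum5 (suc (suc j)) + evenSum5 (suc (suc j))
      ≡⟨ cong (oddSum5 (suc (suc j)) +_) (evenSum5-suc (suc j)) ⟩
    oddSum5 (suc (suc j)) + (evenSum5 (suc j) + qℕ 5 * oddSum5 (suc j))
      ≡⟨ cong₂ (λ a b → a + (b + qℕ 5 * oddSum5 (suc j))) (oddSum5-suc (suc j)) e ⟩
    (oddSum5 (suc j) + evenSum5 (suc j)) + ((oddSum5 (suc j) + evenSum5 (suc j)) - oddSum5 (suc j) + qℕ 5 * oddSum5 (suc j))
      ≡⟨ solve 2 (λ p e → (p :+ e) :+ ((p :+ e) :- p :+ con (qℕ 5) :* p) := con (qℕ 2) :* (p :+ e) :+ con (qℕ 4) :* p) refl (oddSum5 (suc j)) (evenSum5 (suc j)) ⟩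
    qℕ 2 * (oddSum5 (suc j) + evenSum5 (suc j)) + qℕ 4 * oddSum5 (suc j)
      ≡⟨ cong₂ (λ a b → qℕ 2 * a + qℕ 4 * b) (trans (sym (oddSum5-suc (suc j))) (oddSum5≡2^'*fib (suc j))) (oddSum5≡2^'*fib j) ⟩
    qℕ 2 * (qℕ 2 ^' suc j * fib (suc j)) + qℕ 4 * (qℕ 2 ^' j * fib j)
      ≡⟨ solve 3 (λ t a b → con (qℕ 2) :* ((con (qℕ 2) :* t) :* a) :+ con (qℕ 4) :* (t :* b) := con (qℕ 2) :* (con (qℕ 2) :* t) :* (a :+ b)) refl (qℕ 2 ^' j) (fib (suc j)) (fib j) ⟩
    qℕ 2 ^' suc (suc j) * (fib (suc j) + fib j)
      ≡⟨ cong (qℕ 2 ^' suc (suc j) *_) (sym (fib-rec j)) ⟩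
    qℕ 2 ^' suc (suc j) * fib (suc (suc j)) ∎
  where
  open ≡-Reasoning
  e : evenSum5 (suc j) ≡ (oddSum5 (suc j) + evenSum5 (suc j)) - oddSum5 (suc j)
  e = solve 2 (λ p e → e := (p :+ e) :- p) refl (oddSum5 (suc j)) (evenSum5 (suc j))


-- Pochhammer symbols at integers are ratios of factorials, so every summand becomes a
-- product of factorials and their inverses, in which the ring solver exposes pairs x * inv x.

inv-cc : ∀ r → inv (cc r) ≡ weight r * half
inv-cc zero = refl
inv-cc (suc r) = refl

lhsA-term : ∀ k r → let j = k ℕ.+ (k ℕ.+ r) in
  (poch (- (qℕ j * half)) k * poch ((1ℚ - qℕ j) * half) k * (- qℕ 4) ^' k) ÷' (poch (- qℕ j) k * fact k) ≡ qC (j ∸ k) k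
lhsA-term k r = ÷'-solve _ _ _ (*≢0 _ _ (poch-neg≢0 k (k ℕ.+ r)) (fact≢0 k)) (sym cleared)
  where
  open ≡-Reasoning
  j = k ℕ.+ (k ℕ.+ r)
  pj = poch (- qℕ j) k
  shift : - qℕ j + qℕ k ≡ - qℕ (k ℕ.+ r)
  shift = trans (cong (λ z → - z + qℕ k) (trans (qℕ-+ k (k ℕ.+ r)) (cong (qℕ k +_) (qℕ-+ k r)))) (trans (solve 2 (λ k r → :- (k :+ (k :+ r)) :+ k := :- (k :+ r)) refl (qℕ k) (qℕ r)) (cong -_ (sym (qℕ-+ k r))))
  cleared : poch (- (qℕ j * half)) k * poch ((1ℚ - qℕ j) * half) k * (- qℕ 4) ^' k ≡ qC (j ∸ k) k * (pj * fact k)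
  cleared = begin
      poch (- (qℕ j * half)) k * poch ((1ℚ - qℕ j) * half) k * (- qℕ 4) ^' k
        ≡⟨ cong (poch (- (qℕ j * half)) k * poch ((1ℚ - qℕ j) * half) k *_) (neg4^' k) ⟩
      poch (- (qℕ j * half)) k * poch ((1ℚ - qℕ j) * half) k * (sign k * qℕ 4 ^' k)
        ≡⟨ solve 4 (λ a b s f → a :* b :* (s :* f) := s :* (a :* b :* f)) refl (poch (- (qℕ j * half)) k) (poch ((1ℚ - qℕ j) * half) k) (sign k) (qℕ 4 ^' k) ⟩
      sign k * (poch (- (qℕ j * half)) k * poch ((1ℚ - qℕ j) * half) k * qℕ 4 ^' k)
        ≡⟨ cong (sign k *_) (trans (poch-duplication j k) (poch-+ (- qℕ j) k k)) ⟩
      sign k * (pj * poch (- qℕ j + qℕ k) k)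
        ≡⟨ cong (λ z → sign k * (pj * poch z k)) shift ⟩
      sign k * (pj * poch (- qℕ (k ℕ.+ r)) k)
        ≡⟨ cong (λ z → sign k * (pj * z)) (poch-neg≡fact k r) ⟩
      sign k * (pj * (sign k * fact (k ℕ.+ r) * inv (fact r)))
        ≡⟨ solve 4 (λ s p f i → s :* (p :* (s :* f :* i)) := (s :* s) :* (f :* i :* p)) refl (sign k) pj (fact (k ℕ.+ r)) (inv (fact r)) ⟩
      (sign k * sign k) * (fact (k ℕ.+ r) * inv (fact r) * pj)
        ≡⟨ trans (cong (_* (fact (k ℕ.+ r) * inv (fact r) * pj)) (sign-*-sign k)) (QP.*-identityˡ _) ⟩
      fact (k ℕ.+ r) * inv (fact r) * pj
        ≡⟨ sym (*-≡1ʳ _ _ (*-inv (fact k) (fact≢0 k))) ⟩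
      fact (k ℕ.+ r) * inv (fact r) * pj * (fact k * inv (fact k))
        ≡⟨ solve 5 (λ f i p a b → f :* i :* p :* (a :* b) := (f :* b :* i) :* (p :* a)) refl (fact (k ℕ.+ r)) (inv (fact r)) pj (fact k) (inv (fact k)) ⟩
      (fact (k ℕ.+ r) * inv (fact k) * inv (fact r)) * (pj * fact k)
        ≡⟨ cong (_* (pj * fact k)) (sym (qC≡fact k r)) ⟩
      qC (k ℕ.+ r) k * (pj * fact k)
        ≡⟨ cong (λ z → qC z k * (pj * fact k)) (sym (NP.m+n∸m≡n k (k ℕ.+ r))) ⟩
      qC (j ∸ k) k * (pj * fact k) ∎

lhsB-term : ∀ k r → let j = (k ℕ.+ k) ℕ.+ r in
  (poch (- (qℕ j * half)) k * poch ((1ℚ - qℕ j) * half) k * qℕ 5 ^' k) ÷' (poch (ℤ.+ 3 Q./ 2) k * fact k)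
    ≡ inv (qℕ (suc j)) * (qℕ 5 ^' k * qC (suc j) (suc (k ℕ.+ k)))
lhsB-term k r = ÷'-solve _ _ _ den≢0 (*-cancelʳ _ _ X X≢0 (trans lhs-cleared (sym rhs-cleared)))
  where
  open ≡-Reasoning
  j = (k ℕ.+ k) ℕ.+ r
  P1 = poch (- (qℕ j * half)) k
  P2 = poch ((1ℚ - qℕ j) * half) k
  den = poch (ℤ.+ 3 Q./ 2) k * fact k
  den≢0 : den ≢ 0ℚ
  den≢0 e = fact≢0 (suc (k ℕ.+ k)) (trans (sym (poch-3/2 k)) (trans (cong (_* qℕ 4 ^' k) e) (QP.*-zeroˡ (qℕ 4 ^' k))))
  X = qℕ 4 ^' k * fact r
  X≢0 : X ≢ 0ℚ
  X≢0 = *≢0 _ _ (^'≢0 (qℕ 4) k (λ ())) (fact≢0 r)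
  term = inv (qℕ (suc j)) * (qℕ 5 ^' k * qC (suc j) (suc (k ℕ.+ k)))
  lhs-cleared : term * den * X ≡ qℕ 5 ^' k * fact j
  lhs-cleared = begin
      term * den * X
        ≡⟨ solve 7 (λ i f c p g q h → i :* (f :* c) :* (p :* g) :* (q :* h) := (f :* i) :* (c :* (p :* g :* q) :* h)) refl
             (inv (qℕ (suc j))) (qℕ 5 ^' k) (qC (suc j) (suc (k ℕ.+ k))) (poch (ℤ.+ 3 Q./ 2) k) (fact k) (qℕ 4 ^' k) (fact r) ⟩
      (qℕ 5 ^' k * inv (qℕ (suc j))) * (qC (suc j) (suc (k ℕ.+ k)) * (poch (ℤ.+ 3 Q./ 2) k * fact k * qℕ 4 ^' k) * fact r)
        ≡⟨ cong (λ z → (qℕ 5 ^' k * inv (qℕ (suc j))) * (qC (suc j) (suc (k ℕ.+ k)) * z * fact r)) (poch-3/2 k) ⟩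
      (qℕ 5 ^' k * inv (qℕ (suc j))) * (qC (suc j) (suc (k ℕ.+ k)) * fact (suc (k ℕ.+ k)) * fact r)
        ≡⟨ cong ((qℕ 5 ^' k * inv (qℕ (suc j))) *_) (trans (QP.*-assoc (qC (suc j) (suc (k ℕ.+ k))) (fact (suc (k ℕ.+ k))) (fact r)) (qC*fact*fact (suc (k ℕ.+ k)) r)) ⟩
      (qℕ 5 ^' k * inv (qℕ (suc j))) * fact (suc j)
        ≡⟨ cong ((qℕ 5 ^' k * inv (qℕ (suc j))) *_) (fact-suc j) ⟩
      (qℕ 5 ^' k * inv (qℕ (suc j))) * (qℕ (suc j) * fact j)
        ≡⟨ solve 4 (λ f i q g → (f :* i) :* (q :* g) := f :* g :* (q :* i)) refl (qℕ 5 ^' k) (inv (qℕ (suc j))) (qℕ (suc j)) (fact j) ⟩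
      qℕ 5 ^' k * fact j * (qℕ (suc j) * inv (qℕ (suc j)))
        ≡⟨ *-≡1ʳ _ _ (*-inv (qℕ (suc j)) (qℕ-suc≢0 j)) ⟩
      qℕ 5 ^' k * fact j ∎
  rhs-cleared : P1 * P2 * qℕ 5 ^' k * X ≡ qℕ 5 ^' k * fact j
  rhs-cleared = begin
      P1 * P2 * qℕ 5 ^' k * X
        ≡⟨ solve 5 (λ a b f q h → a :* b :* f :* (q :* h) := f :* ((a :* b :* q) :* h)) refl P1 P2 (qℕ 5 ^' k) (qℕ 4 ^' k) (fact r) ⟩
      qℕ 5 ^' k * ((P1 * P2 * qℕ 4 ^' k) * fact r)
        ≡⟨ cong (λ z → qℕ 5 ^' k * (z * fact r)) (poch-duplication j k) ⟩
      qℕ 5 ^' k * (poch (- qℕ j) (k ℕ.+ k) * fact r)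
        ≡⟨ cong (qℕ 5 ^' k *_) (poch-neg*fact (k ℕ.+ k) r) ⟩
      qℕ 5 ^' k * (sign (k ℕ.+ k) * fact j)
        ≡⟨ cong (λ z → qℕ 5 ^' k * (z * fact j)) (sign-even k) ⟩
      qℕ 5 ^' k * (1ℚ * fact j)
        ≡⟨ cong (qℕ 5 ^' k *_) (QP.*-identityˡ (fact j)) ⟩
      qℕ 5 ^' k * fact j ∎

midA-term : ∀ k i r → let m = k ℕ.+ i ; n = (k ℕ.+ k) ℕ.+ r in
  (1ℚ ÷' cc r) * qC (m ℕ.+ r) r * (qℕ 2 ^' (2 ℕ.* m ℕ.+ 1) ÷' qℕ 2 ^' ((m ℕ.+ m) ℕ.+ r))
   * ((poch (- qℕ m) k * poch (qℕ (m ℕ.+ r ℕ.+ 1)) k * (- ¼) ^' k) ÷' (poch (qℕ (r ℕ.+ 1)) k * fact k))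
  ≡ qC (i ℕ.+ n) i * inv (qℕ 2 ^' n) * (qC n k * weight r)
midA-term k i r = begin
    inv (cc r) * qC (m ℕ.+ r) r * (qℕ 2 ^' (2 ℕ.* m ℕ.+ 1) ÷' qℕ 2 ^' ((m ℕ.+ m) ℕ.+ r)) * ((PM * PB * (- ¼) ^' k) ÷' (PR * fact k))
      ≡⟨ cong (inv (cc r) * qC (m ℕ.+ r) r * (qℕ 2 ^' (2 ℕ.* m ℕ.+ 1) ÷' qℕ 2 ^' ((m ℕ.+ m) ℕ.+ r)) *_) (trans (÷'≡*inv (PM * PB * (- ¼) ^' k) (PR * fact k)) (cong (PM * PB * (- ¼) ^' k *_) (inv-distrib-* PR (fact k)))) ⟩
    inv (cc r) * qC (m ℕ.+ r) r * (qℕ 2 ^' (2 ℕ.* m ℕ.+ 1) ÷' qℕ 2 ^' ((m ℕ.+ m) ℕ.+ r)) * ((PM * PB * (- ¼) ^' k) * (inv PR * inv (fact k)))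
      ≡⟨ cong (λ z → z * ((PM * PB * (- ¼) ^' k) * (inv PR * inv (fact k)))) (cong₃ (λ a b c → a * b * c) (inv-cc r) (qC≡fact′ m r) (2^'÷2^' m r)) ⟩
    (weight r * half) * (Fmr * iFm * iFr) * (qℕ 2 * iP2r) * ((PM * PB * (- ¼) ^' k) * (inv PR * inv (fact k)))
      ≡⟨ cong ((weight r * half) * (Fmr * iFm * iFr) * (qℕ 2 * iP2r) *_) (cong₄ (λ a b c d → (a * b * c) * (d * iFk)) (poch-neg≡fact k i) (poch-+1≡fact (m ℕ.+ r) k) (neg¼^' k) (inv-poch-+1 r k)) ⟩
    (weight r * half) * (Fmr * iFm * iFr) * (qℕ 2 * iP2r) * (((s * Fm * iFi) * (Fmrk * iFmr) * (s * Q)) * ((iFkr * Fr) * iFk))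
      ≡⟨ drop-*1 _ _ _ (solve 16 (λ d h Fmr iFm iFr t iP2r s Fm iFi Fmrk iFmr Q iFkr Fr iFk →
              (d :* h) :* (Fmr :* iFm :* iFr) :* (t :* iP2r) :* (((s :* Fm :* iFi) :* (Fmrk :* iFmr) :* (s :* Q)) :* ((iFkr :* Fr) :* iFk))
              := (d :* Q :* iP2r :* iFi :* iFk :* iFkr :* Fmrk) :* (((Fmr :* iFmr) :* (Fm :* iFm)) :* ((Fr :* iFr) :* ((s :* s) :* (h :* t))))) refl
              (weight r) half Fmr iFm iFr (qℕ 2) iP2r s Fm iFi Fmrk iFmr Q iFkr Fr iFk)
           (*-≡1 (*-≡1 (*-inv Fmr (fact≢0 (m ℕ.+ r))) (*-inv Fm (fact≢0 m))) (*-≡1 (*-inv Fr (fact≢0 r)) (*-≡1 (sign-*-sign k) refl))) ⟩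
    weight r * Q * iP2r * iFi * iFk * iFkr * Fmrk
      ≡⟨ cong (weight r * Q * iP2r * iFi * iFk * iFkr *_) (cong fact eN) ⟩
    weight r * Q * iP2r * iFi * iFk * iFkr * fact (i ℕ.+ n)
      ≡⟨ sym (drop-*1 _ _ _ (solve 9 (λ d Q iP Fin iFi iFk iFkr Fn iFn → ((Fin :* iFi :* iFn) :* (Q :* iP) :* ((Fn :* iFk :* iFkr) :* d))
              := (d :* Q :* iP :* iFi :* iFk :* iFkr :* Fin) :* (Fn :* iFn)) refl
              (weight r) Q iP2r (fact (i ℕ.+ n)) iFi iFk iFkr (fact n) (inv (fact n))) (*-inv (fact n) (fact≢0 n))) ⟩
    (fact (i ℕ.+ n) * iFi * inv (fact n)) * (Q * iP2r) * ((fact n * iFk * iFkr) * weight r)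
      ≡⟨ cong₃ (λ a b c → a * b * (c * weight r)) (sym (qC≡fact i n)) (sym (inv-2^'-even-+ k r)) (sym eCn) ⟩
    qC (i ℕ.+ n) i * inv (qℕ 2 ^' n) * (qC n k * weight r) ∎
  where
  open ≡-Reasoning
  m = k ℕ.+ i
  n = (k ℕ.+ k) ℕ.+ r
  PM = poch (- qℕ m) k
  PB = poch (qℕ (m ℕ.+ r ℕ.+ 1)) k
  PR = poch (qℕ (r ℕ.+ 1)) k
  Fmr = fact (m ℕ.+ r)
  iFmr = inv (fact (m ℕ.+ r))
  Fmrk = fact ((m ℕ.+ r) ℕ.+ k)
  Fm = fact m
  Fr = fact r
  iFm = inv (fact m)
  iFr = inv (fact r)
  iFi = inv (fact i)
  iFk = inv (fact k)
  iFkr = inv (fact (k ℕ.+ r))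
  iP2r = inv (qℕ 2 ^' r)
  s = sign k
  Q = ¼ ^' k
  eN : (m ℕ.+ r) ℕ.+ k ≡ i ℕ.+ n
  eN = NSol.solve 3 (λ k i r → (k NSol.:+ i NSol.:+ r) NSol.:+ k NSol.:= i NSol.:+ ((k NSol.:+ k) NSol.:+ r)) refl k i r
  eCn : qC n k ≡ fact n * iFk * iFkr
  eCn = trans (cong (λ z → qC z k) (NP.+-assoc k k r)) (trans (qC≡fact k (k ℕ.+ r)) (cong (λ z → fact z * iFk * iFkr) (sym (NP.+-assoc k k r))))

midB-term : ∀ k i r → let m = k ℕ.+ i in
  (qℕ 5 ^' m ÷' cc r) * qC (m ℕ.+ r) r * ((poch (- qℕ m) k * poch (- qℕ m) k * ⅕ ^' k) ÷' (poch (qℕ (r ℕ.+ 1)) k * fact k))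
    ≡ half * weight r * (qC m i * qC (m ℕ.+ r) i * qℕ 5 ^' i)
midB-term k i r = begin
    (qℕ 5 ^' m ÷' cc r) * qC (m ℕ.+ r) r * ((PM * PM * ⅕ ^' k) ÷' (PR * fact k))
      ≡⟨ cong₂ (λ a b → a * qC (m ℕ.+ r) r * b) (÷'≡*inv (qℕ 5 ^' m) (cc r)) (trans (÷'≡*inv (PM * PM * ⅕ ^' k) (PR * fact k)) (cong (PM * PM * ⅕ ^' k *_) (inv-distrib-* PR (fact k)))) ⟩
    (qℕ 5 ^' m * inv (cc r)) * qC (m ℕ.+ r) r * ((PM * PM * ⅕ ^' k) * (inv PR * inv (fact k)))
      ≡⟨ cong₅ (λ a b c d e → (a * b) * c * ((d * d * ⅕ ^' k) * (e * inv (fact k)))) (^'-+ (qℕ 5) k i) (inv-cc r) (qC≡fact′ m r) (poch-neg≡fact k i) (inv-poch-+1 r k) ⟩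
    ((F5k * F5i) * (weight r * half)) * (Fmr * iFm * iFr) * (((s * Fm * iFi) * (s * Fm * iFi) * QK) * ((iFkr * Fr) * iFk))
      ≡⟨ drop-*1 _ _ _ (solve 15 (λ F5k F5i d h Fmr iFm iFr s Fm iFi QK iFkr Fr iFk iFk' →
             ((F5k :* F5i) :* (d :* h)) :* (Fmr :* iFm :* iFr) :* (((s :* Fm :* iFi) :* (s :* Fm :* iFi) :* QK) :* ((iFkr :* Fr) :* iFk))
             := (h :* d :* ((Fm :* iFk :* iFi) :* (Fmr :* iFi :* iFkr) :* F5i)) :* (((Fm :* iFm) :* (Fr :* iFr)) :* ((QK :* F5k) :* (s :* s)))) refl
             F5k F5i (weight r) half Fmr iFm iFr s Fm iFi QK iFkr Fr iFk iFk)
           (*-≡1 (*-≡1 (*-inv Fm (fact≢0 m)) (*-inv Fr (fact≢0 r))) (*-≡1 (⅕^'*5^' k) (sign-*-sign k))) ⟩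
    half * weight r * ((Fm * iFk * iFi) * (Fmr * iFi * iFkr) * F5i)
      ≡⟨ cong₂ (λ a b → half * weight r * (a * b * F5i)) (sym (qC≡fact′ k i)) (sym eCmri) ⟩
    half * weight r * (qC m i * qC (m ℕ.+ r) i * qℕ 5 ^' i) ∎
  where
  open ≡-Reasoning
  m = k ℕ.+ i
  PM = poch (- qℕ m) k
  PR = poch (qℕ (r ℕ.+ 1)) k
  F5k = qℕ 5 ^' k
  F5i = qℕ 5 ^' i
  Fmr = fact (m ℕ.+ r)
  Fm = fact m
  Fr = fact r
  iFm = inv (fact m)
  iFr = inv (fact r)
  iFi = inv (fact i)
  iFk = inv (fact k)
  iFkr = inv (fact (k ℕ.+ r))
  s = sign k
  QK = ⅕ ^' k
  eCmri : qC (m ℕ.+ r) i ≡ Fmr * iFi * iFkr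
  eCmri = begin
      qC (m ℕ.+ r) i ≡⟨ cong (λ z → qC z i) e ⟩
      qC (i ℕ.+ (k ℕ.+ r)) i ≡⟨ qC≡fact i (k ℕ.+ r) ⟩
      fact (i ℕ.+ (k ℕ.+ r)) * iFi * iFkr ≡⟨ cong (λ z → fact z * iFi * iFkr) (sym e) ⟩
      Fmr * iFi * iFkr ∎
    where
    e : m ℕ.+ r ≡ i ℕ.+ (k ℕ.+ r)
    e = trans (cong (ℕ._+ r) (NP.+-comm k i)) (NP.+-assoc i k r)

rhsA-summand′-factorial : ∀ k l r → let n = (l ℕ.+ l) ℕ.+ r in
  qC (k ℕ.+ n) k * qℕ 4 ^' k * inv (qℕ (suc n)) * (qC (suc n) l * sq (qℕ (suc n) - qℕ 2 * qℕ l))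
  ≡ fact (k ℕ.+ n) * inv (fact k) * qℕ 4 ^' k * inv (fact l) * inv (fact ((l ℕ.+ r) ℕ.+ 1)) * (qℕ (r ℕ.+ 1) * qℕ (r ℕ.+ 1))
rhsA-summand′-factorial k l r = sym (begin
    Fkn * iFk * F4 * iFl * iFL1 * (R1 * R1)
      ≡⟨ sym (drop-*1 _ _ _ (solve 11 (λ Fkn iFk iFn F4 Fn iFN FN iFl iFL1 R1 x →
           (Fkn :* iFk :* iFn) :* F4 :* (Fn :* iFN) :* ((FN :* iFl :* iFL1) :* (R1 :* R1))
           := (Fkn :* iFk :* F4 :* iFl :* iFL1 :* (R1 :* R1)) :* ((Fn :* iFn) :* (FN :* iFN))) refl
           Fkn iFk (inv (fact n)) F4 (fact n) (inv (fact (suc n))) (fact (suc n)) iFl iFL1 R1 R1)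
         (*-≡1 (*-inv (fact n) (fact≢0 n)) (*-inv (fact (suc n)) (fact≢0 (suc n))))) ⟩
    (Fkn * iFk * inv (fact n)) * F4 * (fact n * inv (fact (suc n))) * ((fact (suc n) * iFl * iFL1) * (R1 * R1))
      ≡⟨ cong₄ (λ a b c d → a * F4 * b * (c * d)) (sym (qC≡fact k n)) (sym (inv-qℕ-suc n)) (sym eCN) (cong sq (sym eSq)) ⟩
    qC (k ℕ.+ n) k * qℕ 4 ^' k * inv (qℕ (suc n)) * (qC (suc n) l * sq (qℕ (suc n) - qℕ 2 * qℕ l)) ∎)
  where
  open ≡-Reasoning
  n = (l ℕ.+ l) ℕ.+ r
  L1 = (l ℕ.+ r) ℕ.+ 1
  R1 = qℕ (r ℕ.+ 1)
  iFl = inv (fact l)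
  iFL1 = inv (fact L1)
  iFk = inv (fact k)
  Fkn = fact (k ℕ.+ n)
  F4 = qℕ 4 ^' k
  eN1 : suc n ≡ l ℕ.+ L1
  eN1 = NSol.solve 2 (λ l r → NSol.con 1 NSol.:+ ((l NSol.:+ l) NSol.:+ r) NSol.:= l NSol.:+ ((l NSol.:+ r) NSol.:+ NSol.con 1)) refl l r
  eCN : qC (suc n) l ≡ fact (suc n) * iFl * iFL1
  eCN = trans (cong (λ z → qC z l) eN1) (trans (qC≡fact l L1) (cong (λ z → fact z * iFl * iFL1) (sym eN1)))
  eSq : qℕ (suc n) - qℕ 2 * qℕ l ≡ R1
  eSq = trans (cong (λ z → z - qℕ 2 * qℕ l) (trans (qℕ-suc n) (cong (1ℚ +_) (trans (qℕ-+ (l ℕ.+ l) r) (cong (_+ qℕ r) (qℕ-+ l l)))))) (trans (solve 2 (λ l r → con 1ℚ :+ ((l :+ l) :+ r) :- con (qℕ 2) :* l := r :+ con 1ℚ) refl (qℕ l) (qℕ r)) (sym (qℕ-+ r 1)))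

rhsA-term : ∀ k l r → let m = k ℕ.+ l ; j = (m ℕ.+ m) ℕ.+ r ; n = (l ℕ.+ l) ℕ.+ r in
  qC j m * (qℕ ((r ℕ.+ 1) ℕ.^ 2) ÷' qℕ ((m ℕ.+ r) ℕ.+ 1))
   * ((poch (- qℕ m) k * poch (- qℕ ((m ℕ.+ r) ℕ.+ 1)) k * (- qℕ 4) ^' k) ÷' (poch (- qℕ j) k * fact k))
  ≡ qC (k ℕ.+ n) k * qℕ 4 ^' k * inv (qℕ (suc n)) * (qC (suc n) l * sq (qℕ (suc n) - qℕ 2 * qℕ l))
rhsA-term k l r = begin
    qC j m * (qℕ ((r ℕ.+ 1) ℕ.^ 2) ÷' qℕ ((m ℕ.+ r) ℕ.+ 1)) * ((PM * PQ * (- qℕ 4) ^' k) ÷' (PJ * fact k))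
      ≡⟨ cong₂ (λ a b → qC j m * a * b) (÷'≡*inv (qℕ ((r ℕ.+ 1) ℕ.^ 2)) (qℕ ((m ℕ.+ r) ℕ.+ 1))) (trans (÷'≡*inv (PM * PQ * (- qℕ 4) ^' k) (PJ * fact k)) (cong (PM * PQ * (- qℕ 4) ^' k *_) (inv-distrib-* PJ (fact k)))) ⟩
    qC j m * (qℕ ((r ℕ.+ 1) ℕ.^ 2) * inv (qℕ ((m ℕ.+ r) ℕ.+ 1))) * ((PM * PQ * (- qℕ 4) ^' k) * (inv PJ * inv (fact k)))
      ≡⟨ cong₃ (λ a b c → a * (b * c) * ((PM * PQ * (- qℕ 4) ^' k) * (inv PJ * inv (fact k)))) eCj eR2 eIq ⟩
    (Fj * iFm * iFmr) * ((R1 * R1) * (Fmr * iFmr1)) * ((PM * PQ * (- qℕ 4) ^' k) * (inv PJ * inv (fact k)))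
      ≡⟨ cong ((Fj * iFm * iFmr) * ((R1 * R1) * (Fmr * iFmr1)) *_) (cong₄ (λ a b c d → (a * b * c) * (d * inv (fact k))) (poch-neg≡fact k l) ePQ (neg4^' k) ePJ) ⟩
    (Fj * iFm * iFmr) * ((R1 * R1) * (Fmr * iFmr1)) * (((s * Fm * iFl) * (s * Fmr1 * iFL1) * (s * F4)) * ((s * iFj * Fkn) * iFk))
      ≡⟨ drop-*1 _ _ _ (solve 16 (λ Fj iFm iFmr R1 Fmr iFmr1 s Fm iFl Fmr1 iFL1 F4 iFj Fkn iFk iFk' →
           (Fj :* iFm :* iFmr) :* ((R1 :* R1) :* (Fmr :* iFmr1)) :* (((s :* Fm :* iFl) :* (s :* Fmr1 :* iFL1) :* (s :* F4)) :* ((s :* iFj :* Fkn) :* iFk))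
           := (Fkn :* iFk :* F4 :* iFl :* iFL1 :* (R1 :* R1)) :* (((Fj :* iFj) :* (Fm :* iFm)) :* (((Fmr :* iFmr) :* (Fmr1 :* iFmr1)) :* ((s :* s) :* (s :* s))))) refl
           Fj iFm iFmr R1 Fmr iFmr1 s Fm iFl Fmr1 iFL1 F4 iFj Fkn iFk iFk)
         (*-≡1 (*-≡1 (*-inv Fj (fact≢0 j)) (*-inv Fm (fact≢0 m))) (*-≡1 (*-≡1 (*-inv Fmr (fact≢0 (m ℕ.+ r))) (*-inv Fmr1 (fact≢0 (suc (m ℕ.+ r))))) (*-≡1 (sign-*-sign k) (sign-*-sign k)))) ⟩
    Fkn * iFk * F4 * iFl * iFL1 * (R1 * R1)
      ≡⟨ sym (rhsA-summand′-factorial k l r) ⟩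
    qC (k ℕ.+ n) k * qℕ 4 ^' k * inv (qℕ (suc n)) * (qC (suc n) l * sq (qℕ (suc n) - qℕ 2 * qℕ l)) ∎
  where
  open ≡-Reasoning
  m = k ℕ.+ l
  j = (m ℕ.+ m) ℕ.+ r
  n = (l ℕ.+ l) ℕ.+ r
  L1 = (l ℕ.+ r) ℕ.+ 1
  PM = poch (- qℕ m) k
  PQ = poch (- qℕ ((m ℕ.+ r) ℕ.+ 1)) k
  PJ = poch (- qℕ j) k
  R1 = qℕ (r ℕ.+ 1)
  Fj = fact j
  iFj = inv (fact j)
  Fm = fact m
  iFm = inv (fact m)
  Fmr = fact (m ℕ.+ r)
  iFmr = inv (fact (m ℕ.+ r))
  Fmr1 = fact (suc (m ℕ.+ r))
  iFmr1 = inv (fact (suc (m ℕ.+ r)))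
  iFl = inv (fact l)
  iFL1 = inv (fact L1)
  iFk = inv (fact k)
  Fkn = fact (k ℕ.+ n)
  F4 = qℕ 4 ^' k
  s = sign k
  ej : j ≡ m ℕ.+ (m ℕ.+ r)
  ej = NP.+-assoc m m r
  eCj : qC j m ≡ Fj * iFm * iFmr
  eCj = trans (cong (λ z → qC z m) ej) (trans (qC≡fact m (m ℕ.+ r)) (cong (λ z → fact z * iFm * iFmr) (sym ej)))
  eR2 : qℕ ((r ℕ.+ 1) ℕ.^ 2) ≡ R1 * R1
  eR2 = trans (qℕ-* (r ℕ.+ 1) ((r ℕ.+ 1) ℕ.* 1)) (cong (R1 *_) (trans (qℕ-* (r ℕ.+ 1) 1) (QP.*-identityʳ R1)))
  eIq : inv (qℕ ((m ℕ.+ r) ℕ.+ 1)) ≡ Fmr * iFmr1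
  eIq = trans (cong (λ z → inv (qℕ z)) (NP.+-comm (m ℕ.+ r) 1)) (inv-qℕ-suc (m ℕ.+ r))
  eL : (m ℕ.+ r) ℕ.+ 1 ≡ k ℕ.+ L1
  eL = NSol.solve 3 (λ k l r → ((k NSol.:+ l) NSol.:+ r) NSol.:+ NSol.con 1 NSol.:= k NSol.:+ ((l NSol.:+ r) NSol.:+ NSol.con 1)) refl k l r
  ePQ : PQ ≡ s * Fmr1 * iFL1
  ePQ = begin
      PQ ≡⟨ cong (λ z → poch (- qℕ z) k) eL ⟩
      poch (- qℕ (k ℕ.+ L1)) k ≡⟨ poch-neg≡fact k L1 ⟩
      s * fact (k ℕ.+ L1) * iFL1 ≡⟨ cong (λ z → s * fact z * iFL1) (trans (sym eL) (NP.+-comm (m ℕ.+ r) 1)) ⟩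
      s * Fmr1 * iFL1 ∎
  eJ : j ≡ k ℕ.+ (k ℕ.+ n)
  eJ = NSol.solve 3 (λ k l r → ((k NSol.:+ l) NSol.:+ (k NSol.:+ l)) NSol.:+ r NSol.:= k NSol.:+ (k NSol.:+ ((l NSol.:+ l) NSol.:+ r))) refl k l r
  ePJ : inv PJ ≡ s * iFj * Fkn
  ePJ = begin
      inv PJ ≡⟨ cong (λ z → inv (poch (- qℕ z) k)) eJ ⟩
      inv (poch (- qℕ (k ℕ.+ (k ℕ.+ n))) k) ≡⟨ inv-poch-neg k (k ℕ.+ n) ⟩
      s * inv (fact (k ℕ.+ (k ℕ.+ n))) * Fkn ≡⟨ cong (λ z → s * inv (fact z) * Fkn) (sym eJ) ⟩
      s * iFj * Fkn ∎


-- The two common values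

commonA : ℕ → ℚ
commonA j = sumTo ⌊ j /2⌋ (λ k → qC (j ∸ k) k)

commonB : ℕ → ℚ
commonB j = inv (qℕ (suc j)) * sumTo ⌊ j /2⌋ (λ k → qℕ 5 ^' k * qC (suc j) (suc (k ℕ.+ k)))

commonA-tail : ∀ j k → ⌊ j /2⌋ < k → qC (j ∸ k) k ≡ 0ℚ
commonA-tail j k lt = qC-> (j ∸ k) k (∸< j k (⌊/2⌋<⇒<+ j k lt))

commonB-tail : ∀ j k → ⌊ j /2⌋ < k → qC (suc j) (suc (k ℕ.+ k)) ≡ 0ℚ
commonB-tail j k lt = qC-> (suc j) (suc (k ℕ.+ k)) (s≤s (⌊/2⌋<⇒<+ j k lt))

commonA≡fib : ∀ j → commonA j ≡ fib j
commonA≡fib j = sym (sum-zero-tail′ ⌊ j /2⌋ j (λ k → qC (j ∸ k) k) (NP.⌊n/2⌋≤n j) (λ k lt _ → commonA-tail j k lt))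

oddSum5Upto : ℕ → ℚ
oddSum5Upto j = sumTo j (λ k → qℕ 5 ^' k * qC (suc j) (suc (k ℕ.+ k)))

commonB≡oddSum5Upto : ∀ j → commonB j ≡ inv (qℕ (suc j)) * oddSum5Upto j
commonB≡oddSum5Upto j = cong (inv (qℕ (suc j)) *_) (sym (sum-zero-tail′ ⌊ j /2⌋ j _ (NP.⌊n/2⌋≤n j) (λ k lt _ → trans (cong (qℕ 5 ^' k *_) (commonB-tail j k lt)) (QP.*-zeroʳ (qℕ 5 ^' k)))))

oddSum5Upto≡oddSum5 : ∀ j → oddSum5Upto j ≡ oddSum5 (suc j)
oddSum5Upto≡oddSum5 j = sym (trans (cong (oddSum5Upto j +_) last≡0) (QP.+-identityʳ (oddSum5Upto j)))
  where
  last≡0 : qℕ 5 ^' suc j * qC (suc j) (suc (suc j ℕ.+ suc j)) ≡ 0ℚ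
  last≡0 = trans (cong (qℕ 5 ^' suc j *_) (qC-> (suc j) (suc (suc j ℕ.+ suc j)) (s≤s (NP.m≤m+n (suc j) (suc j))))) (QP.*-zeroʳ (qℕ 5 ^' suc j))

lhsA≡commonA : ∀ j → lhsA j ≡ commonA j
lhsA≡commonA j = sum-cong ⌊ j /2⌋ (λ k k≤h → summand k (≤⌊/2⌋⇒+≤ j k k≤h))
  where
  summand : ∀ k → k ℕ.+ k ≤ j → (poch (- (qℕ j * half)) k * poch ((1ℚ - qℕ j) * half) k * (- qℕ 4) ^' k) ÷' (poch (- qℕ j) k * fact k) ≡ qC (j ∸ k) k
  summand k le = subst (λ z → (poch (- (qℕ z * half)) k * poch ((1ℚ - qℕ z) * half) k * (- qℕ 4) ^' k) ÷' (poch (- qℕ z) k * fact k) ≡ qC (z ∸ k) k)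
                  (trans (sym (NP.+-assoc k k (j ∸ (k ℕ.+ k)))) (NP.m+[n∸m]≡n le)) (lhsA-term k (j ∸ (k ℕ.+ k)))

lhsB≡commonB : ∀ j → lhsB j ≡ commonB j
lhsB≡commonB j = trans (sum-cong ⌊ j /2⌋ (λ k k≤h → summand k (≤⌊/2⌋⇒+≤ j k k≤h))) (sum-*ˡ ⌊ j /2⌋ (inv (qℕ (suc j))) (λ k → qℕ 5 ^' k * qC (suc j) (suc (k ℕ.+ k))))
  where
  summand : ∀ k → k ℕ.+ k ≤ j → (poch (- (qℕ j * half)) k * poch ((1ℚ - qℕ j) * half) k * qℕ 5 ^' k) ÷' (poch (ℤ.+ 3 Q./ 2) k * fact k) ≡ inv (qℕ (suc j)) * (qℕ 5 ^' k * qC (suc j) (suc (k ℕ.+ k)))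
  summand k le = subst (λ z → (poch (- (qℕ z * half)) k * poch ((1ℚ - qℕ z) * half) k * qℕ 5 ^' k) ÷' (poch (ℤ.+ 3 Q./ 2) k * fact k) ≡ inv (qℕ (suc z)) * (qℕ 5 ^' k * qC (suc z) (suc (k ℕ.+ k))))
                  (NP.m+[n∸m]≡n le) (lhsB-term k (j ∸ (k ℕ.+ k)))


-- The (m, k) summand with j - 2m and j - m abstracted, to be replaced by r and m + r when j = 2m + r.
midA-summandAt : ℕ → ℕ → ℕ → ℕ → ℕ → ℚ
midA-summandAt a b p m k = (1ℚ ÷' cc a) * qℕ (b C a) * (qℕ 2 ^' (2 ℕ.* m ℕ.+ 1) ÷' qℕ 2 ^' p)
   * ((poch (- qℕ m) k * poch (qℕ (b ℕ.+ 1)) k * (- ¼) ^' k) ÷' (poch (qℕ (a ℕ.+ 1)) k * fact k))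

midA-summand : ℕ → ℕ → ℕ → ℚ
midA-summand j m k = midA-summandAt (j ∸ 2 ℕ.* m) (j ∸ m) j m k

midA-summand′ : ℕ → ℕ → ℕ → ℚ
midA-summand′ j i k = qC (j ∸ i) i * inv (qℕ 2 ^' (j ∸ 2 ℕ.* i)) * (qC (j ∸ 2 ℕ.* i) k * weight ((j ∸ 2 ℕ.* i) ∸ 2 ℕ.* k))

midA-summand-eval : ∀ k i r → let m = k ℕ.+ i ; j = (m ℕ.+ m) ℕ.+ r in midA-summand j m k ≡ midA-summand′ j i k
midA-summand-eval k i r = begin
    midA-summandAt (j ∸ 2 ℕ.* m) (j ∸ m) j m k ≡⟨ cong₂ (λ a b → midA-summandAt a b j m k) (m+m+r∸2m≡r m r) (m+m+r∸m≡m+r m r) ⟩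
    midA-summandAt r (m ℕ.+ r) j m k ≡⟨ midA-term k i r ⟩
    qC (i ℕ.+ n) i * inv (qℕ 2 ^' n) * (qC n k * weight r) ≡⟨ cong-summand′ (sym j∸i≡i+n) (sym j∸2i≡n) (sym n∸2k≡r) ⟩
    midA-summand′ j i k ∎
  where
  open ≡-Reasoning
  m = k ℕ.+ i
  j = (m ℕ.+ m) ℕ.+ r
  n = (k ℕ.+ k) ℕ.+ r
  cong-summand′ : ∀ {a a' b b' c c'} → a ≡ a' → b ≡ b' → c ≡ c' → qC a i * inv (qℕ 2 ^' b) * (qC b k * weight c) ≡ qC a' i * inv (qℕ 2 ^' b') * (qC b' k * weight c')
  cong-summand′ refl refl refl = refl
  j∸i≡i+n : j ∸ i ≡ i ℕ.+ n
  j∸i≡i+n = trans (cong (_∸ i) (NSol.solve 3 (λ k i r → ((k NSol.:+ i) NSol.:+ (k NSol.:+ i)) NSol.:+ r NSol.:= i NSol.:+ (i NSol.:+ ((k NSol.:+ k) NSol.:+ r))) refl k i r)) (NP.m+n∸m≡n i (i ℕ.+ n))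
  j∸2i≡n : j ∸ 2 ℕ.* i ≡ n
  j∸2i≡n = trans (cong₂ _∸_ (NSol.solve 3 (λ k i r → ((k NSol.:+ i) NSol.:+ (k NSol.:+ i)) NSol.:+ r NSol.:= (i NSol.:+ i) NSol.:+ ((k NSol.:+ k) NSol.:+ r)) refl k i r) (2*≡+ i)) (NP.m+n∸m≡n (i ℕ.+ i) n)
  n∸2k≡r : (j ∸ 2 ℕ.* i) ∸ 2 ℕ.* k ≡ r
  n∸2k≡r = trans (cong₂ _∸_ j∸2i≡n (2*≡+ k)) (NP.m+n∸m≡n (k ℕ.+ k) r)

midA-summand≡ : ∀ j i k → (k ℕ.+ i) ℕ.+ (k ℕ.+ i) ≤ j → midA-summand j (k ℕ.+ i) k ≡ midA-summand′ j i k
midA-summand≡ j i k le = subst (λ z → midA-summand z (k ℕ.+ i) k ≡ midA-summand′ z i k) (NP.m+[n∸m]≡n le) (midA-summand-eval k i (j ∸ ((k ℕ.+ i) ℕ.+ (k ℕ.+ i))))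

midA≡commonA : ∀ j → midA j ≡ commonA j
midA≡commonA j = begin
    midA j
      ≡⟨ sum-cong h (λ m _ → sym (sum-*ˡ m (coeff m) (term m))) ⟩
    sumTo h (λ m → sumTo m (λ k → midA-summand j m k))
      ≡⟨ sum-antidiagonal h (midA-summand j) ⟩
    sumTo h (λ i → sumTo (h ∸ i) (λ k → midA-summand j (i ℕ.+ k) k))
      ≡⟨ sum-cong h (λ i i≤h → inner i i≤h) ⟩
    commonA j ∎
  where
  open ≡-Reasoning
  h = ⌊ j /2⌋
  coeff : ℕ → ℚ
  coeff m = (1ℚ ÷' cc (j ∸ 2 ℕ.* m)) * qℕ ((j ∸ m) C (j ∸ 2 ℕ.* m)) * (qℕ 2 ^' (2 ℕ.* m ℕ.+ 1) ÷' qℕ 2 ^' j)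
  term : ℕ → ℕ → ℚ
  term m k = (poch (- qℕ m) k * poch (qℕ (j ∸ m ℕ.+ 1)) k * (- ¼) ^' k) ÷' (poch (qℕ (j ∸ 2 ℕ.* m ℕ.+ 1)) k * fact k)
  inner : ∀ i → i ≤ h → sumTo (h ∸ i) (λ k → midA-summand j (i ℕ.+ k) k) ≡ qC (j ∸ i) i
  inner i i≤h = begin
      sumTo (h ∸ i) (λ k → midA-summand j (i ℕ.+ k) k)
        ≡⟨ sum-cong (h ∸ i) (λ k k≤ → trans (cong (λ z → midA-summand j z k) (NP.+-comm i k)) (midA-summand≡ j i k (≤⌊/2⌋⇒+≤ j (k ℕ.+ i) (NP.≤-trans (NP.≤-reflexive (NP.+-comm k i)) (NP.≤-trans (NP.+-monoʳ-≤ i k≤) (NP.≤-reflexive (NP.m+[n∸m]≡n i≤h))))))) ⟩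
      sumTo (h ∸ i) (λ k → midA-summand′ j i k)
        ≡⟨ cong (λ z → sumTo z (λ k → midA-summand′ j i k)) (⌊/2⌋∸ j i i≤h) ⟩
      sumTo ⌊ n /2⌋ (λ k → (qC (j ∸ i) i * inv (qℕ 2 ^' n)) * (qC n k * weight (n ∸ 2 ℕ.* k)))
        ≡⟨ sum-*ˡ ⌊ n /2⌋ (qC (j ∸ i) i * inv (qℕ 2 ^' n)) (λ k → qC n k * weight (n ∸ 2 ℕ.* k)) ⟩
      (qC (j ∸ i) i * inv (qℕ 2 ^' n)) * sumTo ⌊ n /2⌋ (λ k → qC n k * weight (n ∸ 2 ℕ.* k))
        ≡⟨ cong ((qC (j ∸ i) i * inv (qℕ 2 ^' n)) *_) (sum-qC-palindrome n) ⟩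
      (qC (j ∸ i) i * inv (qℕ 2 ^' n)) * qℕ 2 ^' n
        ≡⟨ drop-*1 _ _ _ (solve 3 (λ c i p → (c :* i) :* p := c :* (p :* i)) refl (qC (j ∸ i) i) (inv (qℕ 2 ^' n)) (qℕ 2 ^' n)) (*-inv (qℕ 2 ^' n) (^'≢0 (qℕ 2) n (λ ()))) ⟩
      qC (j ∸ i) i ∎
    where
    n = j ∸ 2 ℕ.* i

midB-summandAt : ℕ → ℕ → ℕ → ℕ → ℚ
midB-summandAt a b m k = (qℕ 5 ^' m ÷' cc a) * qℕ (b C a) * ((poch (- qℕ m) k * poch (- qℕ m) k * ⅕ ^' k) ÷' (poch (qℕ (a ℕ.+ 1)) k * fact k))

midB-summand : ℕ → ℕ → ℕ → ℚ
midB-summand j m k = midB-summandAt (j ∸ 2 ℕ.* m) (j ∸ m) m k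

midB-summand′ : ℕ → ℕ → ℕ → ℚ
midB-summand′ j m i = half * weight (j ∸ 2 ℕ.* m) * (qC m i * qC (j ∸ m) i * qℕ 5 ^' i)

midB-summand-eval : ∀ k i r → let m = k ℕ.+ i ; j = (m ℕ.+ m) ℕ.+ r in midB-summand j m k ≡ midB-summand′ j m i
midB-summand-eval k i r = begin
    midB-summandAt (j ∸ 2 ℕ.* m) (j ∸ m) m k ≡⟨ cong₂ (λ a b → midB-summandAt a b m k) (m+m+r∸2m≡r m r) (m+m+r∸m≡m+r m r) ⟩
    midB-summandAt r (m ℕ.+ r) m k ≡⟨ midB-term k i r ⟩
    half * weight r * (qC m i * qC (m ℕ.+ r) i * qℕ 5 ^' i) ≡⟨ cong₂ (λ a b → half * weight a * (qC m i * qC b i * qℕ 5 ^' i)) (sym (m+m+r∸2m≡r m r)) (sym (m+m+r∸m≡m+r m r)) ⟩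
    midB-summand′ j m i ∎
  where
  open ≡-Reasoning
  m = k ℕ.+ i
  j = (m ℕ.+ m) ℕ.+ r

midB-summand≡ : ∀ j m k → k ≤ m → m ℕ.+ m ≤ j → midB-summand j m k ≡ midB-summand′ j m (m ∸ k)
midB-summand≡ j m k k≤m le = subst (λ z → midB-summand j z k ≡ midB-summand′ j z (z ∸ k)) em (trans step (cong (midB-summand′ j (k ℕ.+ i)) (sym (NP.m+n∸m≡n k i))))
  where
  i = m ∸ k
  em : k ℕ.+ i ≡ m
  em = NP.m+[n∸m]≡n k≤m
  le' : (k ℕ.+ i) ℕ.+ (k ℕ.+ i) ≤ j
  le' = subst (λ z → z ℕ.+ z ≤ j) (sym em) le
  step : midB-summand j (k ℕ.+ i) k ≡ midB-summand′ j (k ℕ.+ i) i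
  step = subst (λ z → midB-summand z (k ℕ.+ i) k ≡ midB-summand′ z (k ℕ.+ i) i) (NP.m+[n∸m]≡n le') (midB-summand-eval k i (j ∸ ((k ℕ.+ i) ℕ.+ (k ℕ.+ i))))

vandermondeRow : ℕ → ℕ → ℚ
vandermondeRow j m = sumTo j (λ i → qC m i * qC (j ∸ m) i * qℕ 5 ^' i)

midB-inner : ∀ j m → m ≤ ⌊ j /2⌋ → sumTo m (λ k → midB-summand j m k) ≡ half * weight (j ∸ 2 ℕ.* m) * vandermondeRow j m
midB-inner j m m≤h = begin
    sumTo m (λ k → midB-summand j m k) ≡⟨ sum-cong m (λ k k≤m → midB-summand≡ j m k k≤m (≤⌊/2⌋⇒+≤ j m m≤h)) ⟩
    sumTo m (λ k → midB-summand′ j m (m ∸ k)) ≡⟨ sym (sum-reverse m (midB-summand′ j m)) ⟩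
    sumTo m (midB-summand′ j m) ≡⟨ sum-*ˡ m (half * weight (j ∸ 2 ℕ.* m)) (λ i → qC m i * qC (j ∸ m) i * qℕ 5 ^' i) ⟩
    half * weight (j ∸ 2 ℕ.* m) * sumTo m (λ i → qC m i * qC (j ∸ m) i * qℕ 5 ^' i)
      ≡⟨ cong (half * weight (j ∸ 2 ℕ.* m) *_) (sym (sum-zero-tail′ m j _ m≤j (λ i lt _ → trans (cong (λ z → z * qC (j ∸ m) i * qℕ 5 ^' i) (qC-> m i lt)) (solve 2 (λ a b → con 0ℚ :* a :* b := con 0ℚ) refl (qC (j ∸ m) i) (qℕ 5 ^' i))))) ⟩
    half * weight (j ∸ 2 ℕ.* m) * vandermondeRow j m ∎
  where
  open ≡-Reasoning
  m≤j : m ≤ j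
  m≤j = NP.≤-trans m≤h (NP.⌊n/2⌋≤n j)

sum-vandermondeRow : ∀ j → sumTo j (vandermondeRow j) ≡ oddSum5Upto j
sum-vandermondeRow j = begin
    sumTo j (λ m → sumTo j (λ i → qC m i * qC (j ∸ m) i * qℕ 5 ^' i)) ≡⟨ sum-swap j j (λ m i → qC m i * qC (j ∸ m) i * qℕ 5 ^' i) ⟩
    sumTo j (λ i → sumTo j (λ m → qC m i * qC (j ∸ m) i * qℕ 5 ^' i))
      ≡⟨ sum-cong j (λ i _ → trans (sum-cong j (λ m _ → QP.*-comm (qC m i * qC (j ∸ m) i) (qℕ 5 ^' i))) (sum-*ˡ j (qℕ 5 ^' i) (λ m → qC m i * qC (j ∸ m) i))) ⟩
    sumTo j (λ i → qℕ 5 ^' i * sumTo j (λ m → qC m i * qC (j ∸ m) i)) ≡⟨ sum-cong j (λ i _ → cong (qℕ 5 ^' i *_) (vandermonde j i i)) ⟩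
    oddSum5Upto j ∎
  where open ≡-Reasoning

vandermondeRow-sym : ∀ j m → m ≤ j → vandermondeRow j m ≡ vandermondeRow j (j ∸ m)
vandermondeRow-sym j m m≤j = sum-cong j (λ i _ → trans (cong (λ z → z * qℕ 5 ^' i) (QP.*-comm (qC m i) (qC (j ∸ m) i))) (cong (λ z → qC (j ∸ m) i * qC z i * qℕ 5 ^' i) (sym (NP.m∸[m∸n]≡n m≤j))))

midB≡commonB : ∀ j → midB j ≡ commonB j
midB≡commonB j = begin
    (qℕ 2 ÷' qℕ (j ℕ.+ 1)) * sumTo h (λ m → coeff m * F21 m (- qℕ m) (- qℕ m) (qℕ (j ∸ 2 ℕ.* m ℕ.+ 1)) ⅕)
      ≡⟨ cong ((qℕ 2 ÷' qℕ (j ℕ.+ 1)) *_) (sum-cong h (λ m m≤h → trans (sym (sum-*ˡ m (coeff m) (term m))) (midB-inner j m m≤h))) ⟩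
    (qℕ 2 ÷' qℕ (j ℕ.+ 1)) * sumTo h (λ m → half * weight (j ∸ 2 ℕ.* m) * vandermondeRow j m)
      ≡⟨ cong ((qℕ 2 ÷' qℕ (j ℕ.+ 1)) *_) (trans (sum-cong h (λ m _ → solve 3 (λ a b c → a :* b :* c := a :* (c :* b)) refl half (weight (j ∸ 2 ℕ.* m)) (vandermondeRow j m))) (sum-*ˡ h half (λ m → vandermondeRow j m * weight (j ∸ 2 ℕ.* m)))) ⟩
    (qℕ 2 ÷' qℕ (j ℕ.+ 1)) * (half * sumTo h (λ m → vandermondeRow j m * weight (j ∸ 2 ℕ.* m)))
      ≡⟨ cong (λ z → (qℕ 2 ÷' qℕ (j ℕ.+ 1)) * (half * z)) (trans (sym (sum-palindrome j (vandermondeRow j) (vandermondeRow-sym j))) (sum-vandermondeRow j)) ⟩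
    (qℕ 2 ÷' qℕ (j ℕ.+ 1)) * (half * oddSum5Upto j)
      ≡⟨ cong (λ z → z * (half * oddSum5Upto j)) (trans (÷'≡*inv (qℕ 2) (qℕ (j ℕ.+ 1))) (cong (λ z → qℕ 2 * inv (qℕ z)) (NP.+-comm j 1))) ⟩
    (qℕ 2 * inv (qℕ (suc j))) * (half * oddSum5Upto j)
      ≡⟨ solve 3 (λ i p h → (con (qℕ 2) :* i) :* (h :* p) := (con (qℕ 2) :* h) :* (i :* p)) refl (inv (qℕ (suc j))) (oddSum5Upto j) half ⟩
    (qℕ 2 * half) * (inv (qℕ (suc j)) * oddSum5Upto j)
      ≡⟨ QP.*-identityˡ _ ⟩
    inv (qℕ (suc j)) * oddSum5Upto j
      ≡⟨ sym (commonB≡oddSum5Upto j) ⟩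
    commonB j ∎
  where
  open ≡-Reasoning
  h = ⌊ j /2⌋
  coeff : ℕ → ℚ
  coeff m = (qℕ 5 ^' m ÷' cc (j ∸ 2 ℕ.* m)) * qℕ ((j ∸ m) C (j ∸ 2 ℕ.* m))
  term : ℕ → ℕ → ℚ
  term m k = (poch (- qℕ m) k * poch (- qℕ m) k * ⅕ ^' k) ÷' (poch (qℕ (j ∸ 2 ℕ.* m ℕ.+ 1)) k * fact k)


rhsA-summandAt : ℕ → ℕ → ℕ → ℕ → ℕ → ℚ
rhsA-summandAt a b j m k = qℕ (j C m) * (qℕ ((a ℕ.+ 1) ℕ.^ 2) ÷' qℕ (b ℕ.+ 1))
   * ((poch (- qℕ m) k * poch (- qℕ (b ℕ.+ 1)) k * (- qℕ 4) ^' k) ÷' (poch (- qℕ j) k * fact k))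

rhsA-summand : ℕ → ℕ → ℕ → ℚ
rhsA-summand j m k = rhsA-summandAt (j ∸ 2 ℕ.* m) (j ∸ m) j m k

rhsA-summand′ : ℕ → ℕ → ℕ → ℚ
rhsA-summand′ j k l = qC (j ∸ k) k * qℕ 4 ^' k * inv (qℕ (suc (j ∸ 2 ℕ.* k))) * (qC (suc (j ∸ 2 ℕ.* k)) l * sq (qℕ (suc (j ∸ 2 ℕ.* k)) - qℕ 2 * qℕ l))

rhsA-summand-eval : ∀ k l r → let m = k ℕ.+ l ; j = (m ℕ.+ m) ℕ.+ r in rhsA-summand j m k ≡ rhsA-summand′ j k l
rhsA-summand-eval k l r = begin
    rhsA-summandAt (j ∸ 2 ℕ.* m) (j ∸ m) j m k ≡⟨ cong₂ (λ a b → rhsA-summandAt a b j m k) (m+m+r∸2m≡r m r) (m+m+r∸m≡m+r m r) ⟩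
    rhsA-summandAt r (m ℕ.+ r) j m k ≡⟨ rhsA-term k l r ⟩
    qC (k ℕ.+ n) k * qℕ 4 ^' k * inv (qℕ (suc n)) * (qC (suc n) l * sq (qℕ (suc n) - qℕ 2 * qℕ l)) ≡⟨ cong-summand′ (sym j∸k≡k+n) (sym j∸2k≡n) ⟩
    rhsA-summand′ j k l ∎
  where
  open ≡-Reasoning
  m = k ℕ.+ l
  j = (m ℕ.+ m) ℕ.+ r
  n = (l ℕ.+ l) ℕ.+ r
  cong-summand′ : ∀ {a a' b b'} → a ≡ a' → b ≡ b' → qC a k * qℕ 4 ^' k * inv (qℕ (suc b)) * (qC (suc b) l * sq (qℕ (suc b) - qℕ 2 * qℕ l)) ≡ qC a' k * qℕ 4 ^' k * inv (qℕ (suc b')) * (qC (suc b') l * sq (qℕ (suc b') - qℕ 2 * qℕ l))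
  cong-summand′ refl refl = refl
  j∸k≡k+n : j ∸ k ≡ k ℕ.+ n
  j∸k≡k+n = trans (cong (_∸ k) (NSol.solve 3 (λ k l r → ((k NSol.:+ l) NSol.:+ (k NSol.:+ l)) NSol.:+ r NSol.:= k NSol.:+ (k NSol.:+ ((l NSol.:+ l) NSol.:+ r))) refl k l r)) (NP.m+n∸m≡n k (k ℕ.+ n))
  j∸2k≡n : j ∸ 2 ℕ.* k ≡ n
  j∸2k≡n = trans (cong₂ _∸_ (NSol.solve 3 (λ k l r → ((k NSol.:+ l) NSol.:+ (k NSol.:+ l)) NSol.:+ r NSol.:= (k NSol.:+ k) NSol.:+ ((l NSol.:+ l) NSol.:+ r)) refl k l r) (2*≡+ k)) (NP.m+n∸m≡n (k ℕ.+ k) n)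

rhsA-summand≡ : ∀ j k l → (k ℕ.+ l) ℕ.+ (k ℕ.+ l) ≤ j → rhsA-summand j (k ℕ.+ l) k ≡ rhsA-summand′ j k l
rhsA-summand≡ j k l le = subst (λ z → rhsA-summand z (k ℕ.+ l) k ≡ rhsA-summand′ z k l) (NP.m+[n∸m]≡n le) (rhsA-summand-eval k l (j ∸ ((k ℕ.+ l) ℕ.+ (k ℕ.+ l))))

rhsA-scaledSum : ℕ → ℚ
rhsA-scaledSum j = sumTo ⌊ j /2⌋ (λ m → qℕ (j C m) * (qℕ ((j ∸ 2 ℕ.* m ℕ.+ 1) ℕ.^ 2) ÷' qℕ (j ∸ m ℕ.+ 1))
  * F21 m (- qℕ m) (- qℕ (j ∸ m ℕ.+ 1)) (- qℕ j) (- qℕ 4))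

rhsA-scaledSum≡ : ∀ j → rhsA-scaledSum j ≡ qℕ 2 ^' j * commonA j
rhsA-scaledSum≡ j = begin
    rhsA-scaledSum j
      ≡⟨ sum-cong h (λ m _ → sym (sum-*ˡ m (coeff m) (term m))) ⟩
    sumTo h (λ m → sumTo m (λ k → rhsA-summand j m k))
      ≡⟨ sum-triangle h (rhsA-summand j) ⟩
    sumTo h (λ k → sumTo (h ∸ k) (λ l → rhsA-summand j (k ℕ.+ l) k))
      ≡⟨ sum-cong h (λ k k≤h → inner k k≤h) ⟩
    sumTo h (λ k → qℕ 2 ^' j * qC (j ∸ k) k)
      ≡⟨ sum-*ˡ h (qℕ 2 ^' j) (λ k → qC (j ∸ k) k) ⟩
    qℕ 2 ^' j * commonA j ∎
  where
  open ≡-Reasoning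
  h = ⌊ j /2⌋
  coeff : ℕ → ℚ
  coeff m = qℕ (j C m) * (qℕ ((j ∸ 2 ℕ.* m ℕ.+ 1) ℕ.^ 2) ÷' qℕ (j ∸ m ℕ.+ 1))
  term : ℕ → ℕ → ℚ
  term m k = (poch (- qℕ m) k * poch (- qℕ (j ∸ m ℕ.+ 1)) k * (- qℕ 4) ^' k) ÷' (poch (- qℕ j) k * fact k)
  inner : ∀ k → k ≤ h → sumTo (h ∸ k) (λ l → rhsA-summand j (k ℕ.+ l) k) ≡ qℕ 2 ^' j * qC (j ∸ k) k
  inner k k≤h = begin
      sumTo (h ∸ k) (λ l → rhsA-summand j (k ℕ.+ l) k)
        ≡⟨ sum-cong (h ∸ k) (λ l l≤ → rhsA-summand≡ j k l (≤⌊/2⌋⇒+≤ j (k ℕ.+ l) (NP.≤-trans (NP.+-monoʳ-≤ k l≤) (NP.≤-reflexive (NP.m+[n∸m]≡n k≤h))))) ⟩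
      sumTo (h ∸ k) (λ l → rhsA-summand′ j k l)
        ≡⟨ cong (λ z → sumTo z (λ l → rhsA-summand′ j k l)) (⌊/2⌋∸ j k k≤h) ⟩
      sumTo ⌊ n /2⌋ (λ l → factor * (qC (suc n) l * sq (qℕ (suc n) - qℕ 2 * qℕ l)))
        ≡⟨ sum-*ˡ ⌊ n /2⌋ factor (λ l → qC (suc n) l * sq (qℕ (suc n) - qℕ 2 * qℕ l)) ⟩
      factor * sumTo ⌊ n /2⌋ (λ l → qC (suc n) l * sq (qℕ (suc n) - qℕ 2 * qℕ l))
        ≡⟨ cong (factor *_) (sum-qC*sq-half n) ⟩
      qC (j ∸ k) k * qℕ 4 ^' k * inv (qℕ (suc n)) * (qℕ (suc n) * qℕ 2 ^' n)
        ≡⟨ drop-*1 _ _ _ (solve 5 (λ c f i q p → c :* f :* i :* (q :* p) := (c :* (f :* p)) :* (q :* i)) refl (qC (j ∸ k) k) (qℕ 4 ^' k) (inv (qℕ (suc n))) (qℕ (suc n)) (qℕ 2 ^' n)) (*-inv (qℕ (suc n)) (qℕ-suc≢0 n)) ⟩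
      qC (j ∸ k) k * (qℕ 4 ^' k * qℕ 2 ^' n)
        ≡⟨ cong (qC (j ∸ k) k *_) 4^k*2^n≡2^j ⟩
      qC (j ∸ k) k * qℕ 2 ^' j
        ≡⟨ QP.*-comm (qC (j ∸ k) k) (qℕ 2 ^' j) ⟩
      qℕ 2 ^' j * qC (j ∸ k) k ∎
    where
    n = j ∸ 2 ℕ.* k
    factor = qC (j ∸ k) k * qℕ 4 ^' k * inv (qℕ (suc n))
    4^k*2^n≡2^j : qℕ 4 ^' k * qℕ 2 ^' n ≡ qℕ 2 ^' j
    4^k*2^n≡2^j = begin
        qℕ 4 ^' k * qℕ 2 ^' n ≡⟨ cong (_* qℕ 2 ^' n) (trans (^'-* (qℕ 2) (qℕ 2) k) (sym (^'-+ (qℕ 2) k k))) ⟩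
        qℕ 2 ^' (k ℕ.+ k) * qℕ 2 ^' n ≡⟨ sym (^'-+ (qℕ 2) (k ℕ.+ k) n) ⟩
        qℕ 2 ^' ((k ℕ.+ k) ℕ.+ n) ≡⟨ cong (qℕ 2 ^'_) (trans (cong (λ z → (k ℕ.+ k) ℕ.+ (j ∸ z)) (2*≡+ k)) (NP.m+[n∸m]≡n (≤⌊/2⌋⇒+≤ j k k≤h))) ⟩
        qℕ 2 ^' j ∎

rhsA≡commonA : ∀ j → rhsA j ≡ commonA j
rhsA≡commonA j = begin
    inv (qℕ 2 ^' j) * rhsA-scaledSum j ≡⟨ cong (inv (qℕ 2 ^' j) *_) (rhsA-scaledSum≡ j) ⟩
    inv (qℕ 2 ^' j) * (qℕ 2 ^' j * commonA j) ≡⟨ drop-*1 _ _ _ (solve 3 (λ i p t → i :* (p :* t) := t :* (p :* i)) refl (inv (qℕ 2 ^' j)) (qℕ 2 ^' j) (commonA j)) (*-inv (qℕ 2 ^' j) (^'≢0 (qℕ 2) j (λ ()))) ⟩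
    commonA j ∎
  where open ≡-Reasoning

rhsB≡commonB : ∀ j → rhsB j ≡ commonB j
rhsB≡commonB j = begin
    inv (qℕ (j ℕ.+ 1)) * sumTo h (λ m → qℕ 5 ^' m * qℕ (j C m) * ratio m * F21 m (- qℕ m) (1ℚ - qℕ m) (- qℕ j) ⅘)
      ≡⟨ cong₂ _*_ (cong (λ z → inv (qℕ z)) (NP.+-comm j 1)) (sum-cong h (λ m m≤h → summand m (NP.≤-trans m≤h (NP.⌊n/2⌋≤n j)))) ⟩
    inv (qℕ (suc j)) * rhsA-scaledSum j
      ≡⟨ cong (inv (qℕ (suc j)) *_) (rhsA-scaledSum≡ j) ⟩
    inv (qℕ (suc j)) * (qℕ 2 ^' j * commonA j)
      ≡⟨ cong (λ z → inv (qℕ (suc j)) * (qℕ 2 ^' j * z)) (commonA≡fib j) ⟩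
    inv (qℕ (suc j)) * (qℕ 2 ^' j * fib j)
      ≡⟨ cong (inv (qℕ (suc j)) *_) (trans (sym (oddSum5≡2^'*fib j)) (sym (oddSum5Upto≡oddSum5 j))) ⟩
    inv (qℕ (suc j)) * oddSum5Upto j
      ≡⟨ sym (commonB≡oddSum5Upto j) ⟩
    commonB j ∎
  where
  open ≡-Reasoning
  h = ⌊ j /2⌋
  ratio : ℕ → ℚ
  ratio m = qℕ ((j ∸ 2 ℕ.* m ℕ.+ 1) ℕ.^ 2) ÷' qℕ (j ∸ m ℕ.+ 1)
  summand : ∀ m → m ≤ j → qℕ 5 ^' m * qℕ (j C m) * ratio m * F21 m (- qℕ m) (1ℚ - qℕ m) (- qℕ j) ⅘
                   ≡ qℕ (j C m) * ratio m * F21 m (- qℕ m) (- qℕ (j ∸ m ℕ.+ 1)) (- qℕ j) (- qℕ 4)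
  summand m m≤j = begin
      qℕ 5 ^' m * qℕ (j C m) * ratio m * F21 m (- qℕ m) (1ℚ - qℕ m) (- qℕ j) ⅘
        ≡⟨ solve 4 (λ f c y s → f :* c :* y :* s := c :* y :* (f :* s)) refl (qℕ 5 ^' m) (qℕ (j C m)) (ratio m) (F21 m (- qℕ m) (1ℚ - qℕ m) (- qℕ j) ⅘) ⟩
      qℕ (j C m) * ratio m * (qℕ 5 ^' m * F21 m (- qℕ m) (1ℚ - qℕ m) (- qℕ j) ⅘)
        ≡⟨ cong (qℕ (j C m) * ratio m *_) (pfaff m (1ℚ - qℕ m) (- qℕ j) nz) ⟩
      qℕ (j C m) * ratio m * sumTo m (λ s → (poch (- qℕ m) s * poch (- qℕ j - (1ℚ - qℕ m)) s * (- qℕ 4) ^' s) ÷' (poch (- qℕ j) s * fact s))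
        ≡⟨ cong (λ z → qℕ (j C m) * ratio m * sumTo m (λ s → (poch (- qℕ m) s * poch z s * (- qℕ 4) ^' s) ÷' (poch (- qℕ j) s * fact s))) c-b≡ ⟩
      qℕ (j C m) * ratio m * F21 m (- qℕ m) (- qℕ (j ∸ m ℕ.+ 1)) (- qℕ j) (- qℕ 4) ∎
    where
    c-b≡ : - qℕ j - (1ℚ - qℕ m) ≡ - qℕ (j ∸ m ℕ.+ 1)
    c-b≡ = trans (solve 2 (λ j m → :- j :- (con 1ℚ :- m) := :- ((j :- m) :+ con 1ℚ)) refl (qℕ j) (qℕ m))
            (trans (cong (λ z → - (z + 1ℚ)) (sym (qℕ-∸ j m m≤j))) (cong -_ (sym (qℕ-+ (j ∸ m) 1))))
    nz : poch (- qℕ j) m ≢ 0ℚ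
    nz = subst (λ z → poch (- qℕ z) m ≢ 0ℚ) (NP.m+[n∸m]≡n m≤j) (poch-neg≢0 m (j ∸ m))

corollary3 : (j : ℕ) →
    ((lhsA j ≡ midA j) × (midA j ≡ rhsA j)) × ((lhsB j ≡ midB j) × (midB j ≡ rhsB j))
corollary3 j =
  ( (trans (lhsA≡commonA j) (sym (midA≡commonA j)) , trans (midA≡commonA j) (sym (rhsA≡commonA j)))
  , (trans (lhsB≡commonB j) (sym (midB≡commonB j)) , trans (midB≡commonB j) (sym (rhsB≡commonB j))) )
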